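{- $$Q_{132}^{(\emptyset,0,0,0)}(t,x)=\frac{1}{1-txC(t)}.$$ For $k\ge1$, $$Q_{132}^{(\emptyset,0,k,0)}(t,x)=\frac{1}{1-txC(t)-t(1-x)\sum_{j=0}^{k-1}C_jt^j}$$ and $$Q_{132}^{(\emptyset,0,k,0)}(t,0)=\frac{1}{1-t\sum_{j=0}^{k-1}C_jt^j}.$$
   Context: For $\sigma=\sigma_1\cdots\sigma_n\in S_n$ and $k\in\mathbb{N}$, $\mathrm{mmp}^{(\emptyset,0,k,0)}(\sigma)$ is the number of positions $i$ such that there is no $j>i$ with $\sigma_j>\sigma_i$ and there are at least $k$ indices $j<i$ with $\sigma_j<\sigma_i$. $S_n(132)$ is the set of 132-avoiding permutations of $[n]$. $Q_{n,132}^{(\emptyset,0,k,0)}(x)=\sum_{\sigma\in S_n(132)}x^{\mathrm{mmp}^{(\emptyset,0,k,0)}(\sigma)}$ and $Q_{132}^{(\emptyset,0,k,0)}(t,x)=1+\sum_{n\ge1}t^nQ_{n,132}^{(\emptyset,0,k,0)}(x)$. $C(t)=\sum_{n\ge0}C_nt^n=\frac{1-\sqrt{1-4t}}{2t}$, $C_n=\frac{1}{n+1}\binom{2n}{n}$. -}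

module Defs where

open import Data.Nat using (ℕ; zero; suc; _+_; _*_; _∸_; _<ᵇ_; _≤ᵇ_; _≡ᵇ_)
open import Data.Nat.Combinatorics using (_C_)
open import Data.Nat.DivMod using (_/_)
open import Data.Bool using (Bool; true; false; _∧_; _∨_; not; if_then_else_)
open import Data.List using (List; []; _∷_; _++_; [_]; map; concatMap; upTo; length)
open import Data.Integer using (ℤ; +_; -_) renaming (_+_ to _+ℤ_; _*_ to _*ℤ_)
open import Relation.Binary.PropositionalEquality using (_≡_)

-- Permutations of [n] = {1,…,n}, as lists σ₁ ⋯ σₙ (one-line notation)

insertions : ℕ → List ℕ → List (List ℕ)
insertions a []       = (a ∷ []) ∷ []
insertions a (b ∷ bs) = (a ∷ b ∷ bs) ∷ map (b ∷_) (insertions a bs)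

permsOf : List ℕ → List (List ℕ)
permsOf []       = [] ∷ []
permsOf (a ∷ as) = concatMap (insertions a) (permsOf as)

perms : ℕ → List (List ℕ)
perms n = permsOf (map suc (upTo n))

-- 132-containment: indices i<j<l with σᵢ < σₗ < σⱼ

anyᵇ : (ℕ → Bool) → List ℕ → Bool
anyᵇ p []       = false
anyᵇ p (a ∷ as) = p a ∨ anyᵇ p as

has21Above : ℕ → List ℕ → Bool
has21Above a []       = false
has21Above a (b ∷ cs) =
  ((a <ᵇ b) ∧ anyᵇ (λ c → (a <ᵇ c) ∧ (c <ᵇ b)) cs) ∨ has21Above a cs

contains132 : List ℕ → Bool
contains132 []       = false
contains132 (a ∷ as) = has21Above a as ∨ contains132 as

avoids132 : List ℕ → Bool
avoids132 σ = not (contains132 σ)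

-- mmp^(∅,0,k,0)(σ): number of positions i such that no j>i has σⱼ>σᵢ
-- and at least k indices j<i have σⱼ<σᵢ.

countᵇ : (ℕ → Bool) → List ℕ → ℕ
countᵇ p []       = 0
countᵇ p (a ∷ as) = (if p a then 1 else 0) + countᵇ p as

-- prefix = σ₁ ⋯ σ_{i-1}, the list argument = σᵢ ⋯ σₙ
mmpGo : ℕ → List ℕ → List ℕ → ℕ
mmpGo k prefix []       = 0
mmpGo k prefix (a ∷ as) =
  (if not (anyᵇ (λ b → a <ᵇ b) as) ∧ (k ≤ᵇ countᵇ (λ b → b <ᵇ a) prefix) then 1 else 0)
  + mmpGo k (prefix ++ [ a ]) as

mmp : ℕ → List ℕ → ℕ
mmp k σ = mmpGo k [] σ

-- Formal power series in t and x with integer coefficients: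
-- F n m = coefficient of tⁿ xᵐ.

Series : Set
Series = ℕ → ℕ → ℤ

infix 4 _≈ₛ_
_≈ₛ_ : Series → Series → Set
F ≈ₛ G = ∀ n m → F n m ≡ G n m

sumTo : ℕ → (ℕ → ℤ) → ℤ
sumTo zero    f = f 0
sumTo (suc n) f = sumTo n f +ℤ f (suc n)

_⊕_ : Series → Series → Series
(F ⊕ G) n m = F n m +ℤ G n m

⊖_ : Series → Series
(⊖ F) n m = - F n m

_⊖_ : Series → Series → Series
F ⊖ G = F ⊕ (⊖ G)

_⊗_ : Series → Series → Series
(F ⊗ G) n m = sumTo n (λ a → sumTo m (λ b → F a b *ℤ G (n ∸ a) (m ∸ b)))

infixl 6 _⊕_ _⊖_
infixl 7 _⊗_

𝟙 : Series
𝟙 zero zero = + 1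
𝟙 _    _    = + 0

tS : Series
tS (suc zero) zero = + 1
tS _          _    = + 0

xS : Series
xS zero (suc zero) = + 1
xS _    _          = + 0

catalan : ℕ → ℕ
catalan n = ((2 * n) C n) / suc n

Cser : Series
Cser n zero    = + catalan n
Cser n (suc m) = + 0

Ctrunc : ℕ → Series
Ctrunc k n zero    = if n <ᵇ k then + catalan n else + 0
Ctrunc k n (suc m) = + 0

atX0 : Series → Series
atX0 F n zero    = F n 0
atX0 F n (suc m) = + 0

-- Q^(∅,0,k,0)_132(t,x): coefficient of tⁿ xᵐ is the number of
-- σ ∈ S_n(132) with mmp^(∅,0,k,0)(σ) = m  (n = 0 gives the constant 1).

countPerms : ℕ → ℕ → List (List ℕ) → ℕ
countPerms k m []       = 0
countPerms k m (σ ∷ σs) =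
  (if avoids132 σ ∧ (mmp k σ ≡ᵇ m) then 1 else 0) + countPerms k m σs

Q132 : ℕ → Series
Q132 k n m = + countPerms k m (perms n)

module Submission where

-- A 132-avoiding permutation of [n+1] factors uniquely as α′ (n+1) β,
-- where β is a 132-avoiding permutation of [b] and α′ is a 132-avoiding
-- permutation α of [a] shifted up by b (a + b = n): all entries before n+1
-- exceed all entries after it.  In such a permutation no entry of α′ counts
-- for mmp, n+1 counts iff a ≥ k, and the entries of β count as in β.  Since
-- |S_a(132)| = C_a this gives the coefficient recurrence
--   Q_{n+1,m} = Σ_{a+b=n} C_a · #{β ∈ S_b(132) : [k ≤ a] + mmp β = m},
-- which is precisely the statement Q · D_k = 1 for the denominator D_k of the
-- theorem (D_0 = 1 - t x C(t) because the truncation for k = 0 is empty).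
-- Setting x = 0 preserves this identity, giving the third formula.

open import Defs
open import Data.Nat using (ℕ; suc; _≤_)
open import Data.Product using (_×_; _,_)

-- Segner's recurrence C_{n+1} = Σ_{i≤n} C_i C_{n-i} for C_n = C(2n,n)/(n+1):
-- from the ratio (n+2) C_{n+1} = (4n+2) C_n and the symmetry i ↦ n - i of
-- convolutions, which averages the weight i to n/2.
module CatalanNumbers where

  open import Data.Nat
  open import Data.Nat.Properties
  open import Data.Nat.Combinatorics
  open import Data.Nat.DivMod using (_/_; m*n/n≡m; m/n*n≡m)
  open import Data.Nat.Tactic.RingSolver using (solve-∀)
  open import Relation.Binary.PropositionalEquality
  open import Defs using (catalan)
  open ≡-Reasoning

  sumℕ : ℕ → (ℕ → ℕ) → ℕ
  sumℕ zero    f = f 0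
  sumℕ (suc n) f = sumℕ n f + f (suc n)

  sumℕ-cong : ∀ n {f g : ℕ → ℕ} → (∀ i → i ≤ n → f i ≡ g i) → sumℕ n f ≡ sumℕ n g
  sumℕ-cong zero    eq = eq 0 z≤n
  sumℕ-cong (suc n) eq =
    cong₂ _+_ (sumℕ-cong n (λ i i≤n → eq i (m≤n⇒m≤1+n i≤n))) (eq (suc n) ≤-refl)

  sumℕ-+ : ∀ n (f g : ℕ → ℕ) → sumℕ n (λ i → f i + g i) ≡ sumℕ n f + sumℕ n g
  sumℕ-+ zero    f g = refl
  sumℕ-+ (suc n) f g rewrite sumℕ-+ n f g = +-interchange (sumℕ n f) (sumℕ n g) (f (suc n)) (g (suc n))
    where +-interchange : ∀ a b c d → a + b + (c + d) ≡ a + c + (b + d)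
          +-interchange = solve-∀

  sumℕ-*ˡ : ∀ n c (f : ℕ → ℕ) → sumℕ n (λ i → c * f i) ≡ c * sumℕ n f
  sumℕ-*ˡ zero    c f = refl
  sumℕ-*ˡ (suc n) c f rewrite sumℕ-*ˡ n c f = sym (*-distribˡ-+ c (sumℕ n f) (f (suc n)))

  sumℕ-peel : ∀ n (f : ℕ → ℕ) → sumℕ (suc n) f ≡ f 0 + sumℕ n (λ i → f (suc i))
  sumℕ-peel zero    f = refl
  sumℕ-peel (suc n) f rewrite sumℕ-peel n f = +-assoc (f 0) _ _

  sumℕ-reflect : ∀ n (f : ℕ → ℕ) → sumℕ n f ≡ sumℕ n (λ i → f (n ∸ i))
  sumℕ-reflect zero    f = refl
  sumℕ-reflect (suc n) f = begin
    sumℕ (suc n) f                                ≡⟨ sumℕ-peel n f ⟩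
    f 0 + sumℕ n (λ i → f (suc i))                ≡⟨ cong (f 0 +_) (sumℕ-reflect n (λ i → f (suc i))) ⟩
    f 0 + sumℕ n (λ i → f (suc (n ∸ i)))          ≡⟨ +-comm (f 0) _ ⟩
    sumℕ n (λ i → f (suc (n ∸ i))) + f 0          ≡⟨ cong (_+ f 0) (sumℕ-cong n (λ i i≤n → cong f (sym (+-∸-assoc 1 i≤n)))) ⟩
    sumℕ n (λ i → f (suc n ∸ i)) + f 0            ≡⟨ cong (λ j → sumℕ n (λ i → f (suc n ∸ i)) + f j) (sym (n∸n≡0 n)) ⟩
    sumℕ (suc n) (λ i → f (suc n ∸ i))            ∎

  convolution-reflect : ∀ n (f w : ℕ → ℕ) →
    sumℕ n (λ i → w i * (f i * f (n ∸ i))) ≡ sumℕ n (λ i → w (n ∸ i) * (f i * f (n ∸ i)))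
  convolution-reflect n f w = trans (sumℕ-reflect n _) (sumℕ-cong n λ i i≤n →
    trans (cong (λ j → w (n ∸ i) * (f (n ∸ i) * f j)) (m∸[m∸n]≡n i≤n))
          (cong (w (n ∸ i) *_) (*-comm (f (n ∸ i)) (f i))))

  convolution-index-weight : ∀ n (f : ℕ → ℕ) →
    2 * sumℕ n (λ i → i * (f i * f (n ∸ i))) ≡ n * sumℕ n (λ i → f i * f (n ∸ i))
  convolution-index-weight n f = begin
    2 * S                                          ≡⟨⟩
    S + (S + 0)                                    ≡⟨ cong (S +_) (trans (+-identityʳ S) (convolution-reflect n f (λ i → i))) ⟩
    S + sumℕ n (λ i → (n ∸ i) * g i)               ≡⟨ sumℕ-+ n _ _ ⟨
    sumℕ n (λ i → i * g i + (n ∸ i) * g i)         ≡⟨ sumℕ-cong n (λ i i≤n → trans (sym (*-distribʳ-+ (g i) i (n ∸ i)))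
                                                                                    (cong (_* g i) (m+[n∸m]≡n i≤n))) ⟩
    sumℕ n (λ i → n * g i)                         ≡⟨ sumℕ-*ˡ n n g ⟩
    n * sumℕ n g                                   ∎
    where g : ℕ → ℕ
          g i = f i * f (n ∸ i)
          S : ℕ
          S = sumℕ n (λ i → i * g i)

  convolution-succ-weight : ∀ n (f : ℕ → ℕ) →
    suc (suc n) * sumℕ n (λ i → f i * f (n ∸ i)) ≡ 2 * sumℕ n (λ i → suc i * (f i * f (n ∸ i)))
  convolution-succ-weight n f = begin
    suc (suc n) * sumℕ n g                         ≡⟨ sumℕ-*ˡ n (suc (suc n)) g ⟨
    sumℕ n (λ i → suc (suc n) * g i)               ≡⟨ sumℕ-cong n (λ i i≤n → trans (cong (_* g i) (split i i≤n))
                                                                                    (*-distribʳ-+ (g i) (suc i) (suc (n ∸ i)))) ⟩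
    sumℕ n (λ i → suc i * g i + suc (n ∸ i) * g i) ≡⟨ sumℕ-+ n _ _ ⟩
    A + sumℕ n (λ i → suc (n ∸ i) * g i)           ≡⟨ cong (A +_) (sym (convolution-reflect n f suc)) ⟩
    A + A                                          ≡⟨ cong (A +_) (+-identityʳ A) ⟨
    2 * A                                          ∎
    where g : ℕ → ℕ
          g i = f i * f (n ∸ i)
          A : ℕ
          A = sumℕ n (λ i → suc i * g i)
          split : ∀ i → i ≤ n → suc (suc n) ≡ suc i + suc (n ∸ i)
          split i i≤n = trans (cong (λ j → suc (suc j)) (sym (m+[n∸m]≡n i≤n))) (sym (+-suc (suc i) (n ∸ i)))

  convolution-affine-weight : ∀ n (f : ℕ → ℕ) →
    sumℕ n (λ i → (2 + 4 * i) * (f i * f (n ∸ i))) ≡ 2 * suc n * sumℕ n (λ i → f i * f (n ∸ i))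
  convolution-affine-weight n f = begin
    sumℕ n (λ i → (2 + 4 * i) * g i)                          ≡⟨ sumℕ-cong n (λ i _ → expand i (g i)) ⟩
    sumℕ n (λ i → 2 * g i + 2 * (2 * (i * g i)))              ≡⟨ sumℕ-+ n _ _ ⟩
    sumℕ n (λ i → 2 * g i) + sumℕ n (λ i → 2 * (2 * (i * g i)))
      ≡⟨ cong₂ _+_ (sumℕ-*ˡ n 2 g) (trans (sumℕ-*ˡ n 2 _) (cong (2 *_) (sumℕ-*ˡ n 2 _))) ⟩
    2 * sumℕ n g + 2 * (2 * sumℕ n (λ i → i * g i))          ≡⟨ cong (λ s → 2 * sumℕ n g + 2 * s) (convolution-index-weight n f) ⟩
    2 * sumℕ n g + 2 * (n * sumℕ n g)                         ≡⟨ collect n (sumℕ n g) ⟩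
    2 * suc n * sumℕ n g                                      ∎
    where g : ℕ → ℕ
          g i = f i * f (n ∸ i)
          expand : ∀ i x → (2 + 4 * i) * x ≡ 2 * x + 2 * (2 * (i * x))
          expand = solve-∀
          collect : ∀ n s → 2 * s + 2 * (n * s) ≡ 2 * suc n * s
          collect = solve-∀

  choose-factorials : ∀ {n} k j → k + j ≡ n → (n C k) * (k ! * j !) ≡ n !
  choose-factorials k j refl = begin
    ((k + j) C k) * (k ! * j !)                     ≡⟨ cong (λ m → ((k + j) C k) * (k ! * m !)) (sym (m+n∸m≡n k j)) ⟩
    ((k + j) C k) * (k ! * (k + j ∸ k) !)           ≡⟨ cong (_* (k ! * (k + j ∸ k) !)) (nCk≡n!/k![n-k]! k≤k+j) ⟩
    (k + j) ! / (k ! * (k + j ∸ k) !) * (k ! * (k + j ∸ k) !)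
                                                    ≡⟨ m/n*n≡m (k![n∸k]!∣n! k≤k+j) ⟩
    (k + j) !                                       ∎
    where
    k≤k+j : k ≤ k + j
    k≤k+j = m≤m+n k j
    instance
      denominator≢0 : NonZero (k ! * (k + j ∸ k) !)
      denominator≢0 = k !* (k + j ∸ k) !≢0

  -- (a+1) C(2a,a+1) = a C(2a,a): both sides times a!(a-1)! equal (2a)!.
  central-choose-shift : ∀ a → suc a * ((2 * a) C suc a) ≡ a * ((2 * a) C a)
  central-choose-shift zero    = refl
  central-choose-shift (suc b) = *-cancelʳ-≡ _ _ (suc b ! * b !) {{suc b !* b !≢0}} (trans left (sym right))
    where
    a : ℕ
    a = suc b
    left : suc a * ((2 * a) C suc a) * (a ! * b !) ≡ (2 * a) !
    left = trans (regroup (suc a) ((2 * a) C suc a) (a !) (b !)) (choose-factorials (suc a) b (sizes b))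
      where regroup : ∀ A B F G → A * B * (F * G) ≡ B * ((A * F) * G)
            regroup = solve-∀
            sizes : ∀ b → suc (suc b) + b ≡ 2 * suc b
            sizes = solve-∀
    right : a * ((2 * a) C a) * (a ! * b !) ≡ (2 * a) !
    right = trans (regroup a ((2 * a) C a) (a !) (b !)) (choose-factorials a a (sizes b))
      where regroup : ∀ A B F G → A * B * (F * G) ≡ B * (F * (A * G))
            regroup = solve-∀
            sizes : ∀ b → suc b + suc b ≡ 2 * suc b
            sizes = solve-∀

  -- (a+1) C(2a+2,a+1) = 2(2a+1) C(2a,a): both sides times a!(a+1)! equal (2a+2)!.
  central-choose-step : ∀ a → suc a * ((2 * suc a) C suc a) ≡ 2 * suc (2 * a) * ((2 * a) C a)
  central-choose-step a = *-cancelʳ-≡ _ _ (a ! * suc a !) {{a !* suc a !≢0}} (trans left (sym right))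
    where
    left : suc a * ((2 * suc a) C suc a) * (a ! * suc a !) ≡ (2 * suc a) !
    left = trans (regroup (suc a) ((2 * suc a) C suc a) (a !)) (choose-factorials (suc a) (suc a) (sizes a))
      where regroup : ∀ A B F → A * B * (F * (A * F)) ≡ B * ((A * F) * (A * F))
            regroup = solve-∀
            sizes : ∀ a → suc a + suc a ≡ 2 * suc a
            sizes = solve-∀
    right : 2 * suc (2 * a) * ((2 * a) C a) * (a ! * suc a !) ≡ (2 * suc a) !
    right = begin
      2 * suc (2 * a) * ((2 * a) C a) * (a ! * suc a !)
        ≡⟨ regroup a ((2 * a) C a) (a !) ⟩
      suc (suc (2 * a)) * (suc (2 * a) * (((2 * a) C a) * (a ! * a !)))
        ≡⟨ cong (λ m → suc (suc (2 * a)) * (suc (2 * a) * m)) (choose-factorials a a (sizes a)) ⟩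
      suc (suc (2 * a)) * (suc (2 * a) * (2 * a) !)
        ≡⟨ cong _! (double-suc a) ⟨
      (2 * suc a) !
        ∎
      where regroup : ∀ a B F → 2 * suc (2 * a) * B * (F * (suc a * F)) ≡ suc (suc (2 * a)) * (suc (2 * a) * (B * (F * F)))
            regroup = solve-∀
            sizes : ∀ a → a + a ≡ 2 * a
            sizes = solve-∀
            double-suc : ∀ a → 2 * suc a ≡ suc (suc (2 * a))
            double-suc = solve-∀

  -- The defining division is exact: (a+1) C_a = C(2a,a), since C_a = C(2a,a) - C(2a,a+1).
  catalan-spec : ∀ a → catalan a * suc a ≡ (2 * a) C a
  catalan-spec a = trans (cong (_* suc a) catalan≡difference) difference-spec
    where
    B B′ : ℕ
    B  = (2 * a) C a
    B′ = (2 * a) C suc a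
    difference-spec : (B ∸ B′) * suc a ≡ B
    difference-spec = begin
      (B ∸ B′) * suc a          ≡⟨ *-distribʳ-∸ (suc a) B B′ ⟩
      B * suc a ∸ B′ * suc a    ≡⟨ cong₂ _∸_ (*-suc B a) (trans (*-comm B′ (suc a)) (trans (central-choose-shift a) (*-comm a B))) ⟩
      (B + B * a) ∸ B * a       ≡⟨ m+n∸n≡m B (B * a) ⟩
      B                         ∎
    catalan≡difference : catalan a ≡ B ∸ B′
    catalan≡difference = trans (cong (_/ suc a) (sym difference-spec)) (m*n/n≡m (B ∸ B′) (suc a))

  catalan-ratio : ∀ a → suc (suc a) * catalan (suc a) ≡ (2 + 4 * a) * catalan a
  catalan-ratio a = *-cancelˡ-≡ _ _ (suc a) (begin
    suc a * (suc (suc a) * catalan (suc a))  ≡⟨ cong (suc a *_) (trans (*-comm (suc (suc a)) (catalan (suc a))) (catalan-spec (suc a))) ⟩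
    suc a * ((2 * suc a) C suc a)            ≡⟨ central-choose-step a ⟩
    2 * suc (2 * a) * ((2 * a) C a)          ≡⟨ cong (2 * suc (2 * a) *_) (sym (catalan-spec a)) ⟩
    2 * suc (2 * a) * (catalan a * suc a)    ≡⟨ regroup a (catalan a) ⟩
    suc a * ((2 + 4 * a) * catalan a)        ∎)
    where regroup : ∀ a c → 2 * suc (2 * a) * (c * suc a) ≡ suc a * ((2 + 4 * a) * c)
          regroup = solve-∀

  catalan-convolution : ∀ n → sumℕ n (λ i → catalan i * catalan (n ∸ i)) ≡ catalan (suc n)
  catalan-convolution zero     = refl
  catalan-convolution (suc n′) = *-cancelˡ-≡ _ _ (suc (suc n)) (begin
    suc (suc n) * conv n                                    ≡⟨ convolution-succ-weight n c ⟩
    2 * sumℕ n (λ i → suc i * (c i * c (n ∸ i)))            ≡⟨ cong (2 *_) (sumℕ-peel n′ _) ⟩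
    2 * (1 * (c 0 * c n) + sumℕ n′ (λ i → suc (suc i) * (c (suc i) * c (n′ ∸ i))))
      ≡⟨ cong (2 *_) (cong₂ _+_ (trans (*-identityˡ (c 0 * c n)) (*-identityˡ (c n)))
                                (sumℕ-cong n′ (λ i _ → ratio-term i))) ⟩
    2 * (c n + sumℕ n′ (λ i → (2 + 4 * i) * (c i * c (n′ ∸ i))))
      ≡⟨ cong (λ s → 2 * (c n + s)) (convolution-affine-weight n′ c) ⟩
    2 * (c n + 2 * n * conv n′)                             ≡⟨ cong (λ s → 2 * (c n + 2 * n * s)) (catalan-convolution n′) ⟩
    2 * (c n + 2 * n * c n)                                 ≡⟨ collect n′ (c n) ⟩
    (2 + 4 * n) * c n                                       ≡⟨ catalan-ratio n ⟨
    suc (suc n) * c (suc n)                                 ∎)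
    where
    n : ℕ
    n = suc n′
    c : ℕ → ℕ
    c = catalan
    conv : ℕ → ℕ
    conv m = sumℕ m (λ i → c i * c (m ∸ i))
    ratio-term : ∀ i → suc (suc i) * (c (suc i) * c (n′ ∸ i)) ≡ (2 + 4 * i) * (c i * c (n′ ∸ i))
    ratio-term i = trans (sym (*-assoc (suc (suc i)) (c (suc i)) (c (n′ ∸ i))))
                   (trans (cong (_* c (n′ ∸ i)) (catalan-ratio i)) (*-assoc (2 + 4 * i) (c i) (c (n′ ∸ i))))
    collect : ∀ n′ x → 2 * (x + 2 * suc n′ * x) ≡ (2 + 4 * suc n′) * x
    collect = solve-∀

module ListTotals where

  open import Data.Nat
  open import Data.Nat.Properties
  open import Data.Bool using (if_then_else_)
  open import Data.List using (List; []; _∷_; _++_; map; concatMap)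
  open import Data.List.Membership.Propositional using (_∈_; _∉_)
  open import Data.List.Membership.Propositional.Properties using (∈-∃++)
  open import Data.List.Relation.Unary.Any using (here; there)
  open import Data.Product using (_×_; _,_; proj₁; proj₂)
  open import Data.Sum using (_⊎_; inj₁; inj₂)
  open import Data.Empty using (⊥-elim)
  open import Relation.Nullary using (¬_; yes; no; does)
  open import Data.List.Relation.Unary.Unique.Propositional using (Unique; _∷_)
  open import Data.List.Relation.Unary.All.Properties using (All¬⇒¬Any)
  open import Relation.Binary.Definitions using (DecidableEquality)
  open import Relation.Binary.PropositionalEquality

  total : {A : Set} → (A → ℕ) → List A → ℕ
  total f []       = 0
  total f (x ∷ xs) = f x + total f xs

  module _ {A : Set} where

    total-++ : ∀ (f : A → ℕ) xs ys → total f (xs ++ ys) ≡ total f xs + total f ys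
    total-++ f []       ys = refl
    total-++ f (x ∷ xs) ys rewrite total-++ f xs ys = sym (+-assoc (f x) _ _)

    total-cong : ∀ {f g : A → ℕ} xs → (∀ x → x ∈ xs → f x ≡ g x) → total f xs ≡ total g xs
    total-cong []       eq = refl
    total-cong (x ∷ xs) eq = cong₂ _+_ (eq x (here refl)) (total-cong xs (λ y y∈ → eq y (there y∈)))

    total-zero : ∀ {f : A → ℕ} xs → (∀ x → x ∈ xs → f x ≡ 0) → total f xs ≡ 0
    total-zero []       eq = refl
    total-zero (x ∷ xs) eq rewrite eq x (here refl) = total-zero xs (λ y y∈ → eq y (there y∈))

    total-*ˡ : ∀ c (f : A → ℕ) xs → total (λ x → c * f x) xs ≡ c * total f xs
    total-*ˡ c f []       = sym (*-zeroʳ c)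
    total-*ˡ c f (x ∷ xs) rewrite total-*ˡ c f xs = sym (*-distribˡ-+ c (f x) _)

    total-*ʳ : ∀ c (f : A → ℕ) xs → total (λ x → f x * c) xs ≡ total f xs * c
    total-*ʳ c f []       = refl
    total-*ʳ c f (x ∷ xs) rewrite total-*ʳ c f xs = sym (*-distribʳ-+ c (f x) _)

    total-middle : ∀ (f : A → ℕ) P x S → total f (P ++ x ∷ S) ≡ f x + total f (P ++ S)
    total-middle f []      x S = refl
    total-middle f (y ∷ P) x S rewrite total-middle f P x S = +-exchange (f y) (f x) _
      where +-exchange : ∀ a b c → a + (b + c) ≡ b + (a + c)
            +-exchange a b c = trans (sym (+-assoc a b c)) (trans (cong (_+ c) (+-comm a b)) (+-assoc b a c))

  total-map : ∀ {A B : Set} (f : B → ℕ) (g : A → B) xs → total f (map g xs) ≡ total (λ x → f (g x)) xs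
  total-map f g []       = refl
  total-map f g (x ∷ xs) = cong (f (g x) +_) (total-map f g xs)

  total-concatMap : ∀ {A B : Set} (f : B → ℕ) (g : A → List B) xs →
    total f (concatMap g xs) ≡ total (λ x → total f (g x)) xs
  total-concatMap f g []       = refl
  total-concatMap f g (x ∷ xs) =
    trans (total-++ f (g x) (concatMap g xs)) (cong (total f (g x) +_) (total-concatMap f g xs))

  module Multiplicity {A : Set} (_≟_ : DecidableEquality A) where

    -- The Kronecker delta; kept opaque so that it is only used through δ-view.
    opaque
      δ : A → A → ℕ
      δ x y = if does (x ≟ y) then 1 else 0

      δ-view : ∀ x y → (x ≡ y × δ x y ≡ 1) ⊎ (x ≢ y × δ x y ≡ 0)
      δ-view x y with x ≟ y
      ... | yes x≡y = inj₁ (x≡y , refl)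
      ... | no  x≢y = inj₂ (x≢y , refl)

    δ-≡ : ∀ {x y} → x ≡ y → δ x y ≡ 1
    δ-≡ {x} {y} x≡y with δ-view x y
    ... | inj₁ (_ , d)   = d
    ... | inj₂ (x≢y , _) = ⊥-elim (x≢y x≡y)

    δ-≢ : ∀ {x y} → x ≢ y → δ x y ≡ 0
    δ-≢ {x} {y} x≢y with δ-view x y
    ... | inj₁ (x≡y , _) = ⊥-elim (x≢y x≡y)
    ... | inj₂ (_ , d)   = d

    δ-resp-⇔ : ∀ {x y x′ y′} → (x ≡ y → x′ ≡ y′) → (x′ ≡ y′ → x ≡ y) → δ x y ≡ δ x′ y′
    δ-resp-⇔ {x} {y} to from with δ-view x y
    ... | inj₁ (x≡y , d) = trans d (sym (δ-≡ (to x≡y)))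
    ... | inj₂ (x≢y , d) = trans d (sym (δ-≢ (λ e → x≢y (from e))))

    δ-product : ∀ {x y u u′ v v′} → (x ≡ y → u ≡ u′ × v ≡ v′) → (u ≡ u′ → v ≡ v′ → x ≡ y) →
      δ x y ≡ δ u u′ * δ v v′
    δ-product {u = u} {u′} {v} {v′} to from with δ-view u u′ | δ-view v v′
    ... | inj₁ (e₁ , d₁) | inj₁ (e₂ , d₂) rewrite d₁ | d₂ = δ-≡ (from e₁ e₂)
    ... | inj₂ (n₁ , d₁) | _              rewrite d₁      = δ-≢ (λ e → n₁ (proj₁ (to e)))
    ... | inj₁ (_ , d₁)  | inj₂ (n₂ , d₂) rewrite d₁ | d₂ = δ-≢ (λ e → n₂ (proj₂ (to e)))

    multiplicity : A → List A → ℕ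
    multiplicity x = total (δ x)

    multiplicity-pos : ∀ x xs → 0 < multiplicity x xs → x ∈ xs
    multiplicity-pos x (y ∷ xs) pos with δ-view x y
    ... | inj₁ (x≡y , _) = here x≡y
    ... | inj₂ (_ , d) rewrite d = there (multiplicity-pos x xs pos)

    multiplicity-∉ : ∀ x xs → x ∉ xs → multiplicity x xs ≡ 0
    multiplicity-∉ x []       x∉ = refl
    multiplicity-∉ x (y ∷ xs) x∉ = cong₂ _+_ (δ-≢ (λ x≡y → x∉ (here x≡y))) (multiplicity-∉ x xs (λ x∈ → x∉ (there x∈)))

    multiplicity-∈ : ∀ {x xs} → x ∈ xs → 0 < multiplicity x xs
    multiplicity-∈ {x} {y ∷ xs} (here x≡y) rewrite δ-≡ x≡y = s≤s z≤n
    multiplicity-∈ {x} {y ∷ xs} (there x∈) = ≤-trans (multiplicity-∈ x∈) (m≤n+m _ (δ x y))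

    multiplicity-unique : ∀ {x xs} → Unique xs → x ∈ xs → multiplicity x xs ≡ 1
    multiplicity-unique {x} {y ∷ xs} (y∉ ∷ u) (here x≡y) =
      cong₂ _+_ (δ-≡ x≡y) (multiplicity-∉ x xs (λ x∈ → All¬⇒¬Any y∉ (subst (_∈ xs) x≡y x∈)))
    multiplicity-unique {x} {y ∷ xs} (y∉ ∷ u) (there x∈) =
      cong₂ _+_ (δ-≢ (λ x≡y → All¬⇒¬Any y∉ (subst (_∈ xs) x≡y x∈))) (multiplicity-unique u x∈)

    Agree : (A → ℕ) → List A → List A → Set
    Agree f xs ys = ∀ z → 0 < f z → multiplicity z xs ≡ multiplicity z ys

    private
      skip-null : ∀ f x xs ys → ¬ (0 < f x) → Agree f (x ∷ xs) ys → Agree f xs ys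
      skip-null f x xs ys fx≯0 same z fz>0 = trans (cong (_+ multiplicity z xs) (sym (δ-≢ z≢x))) (same z fz>0)
        where z≢x : z ≢ x
              z≢x refl = fx≯0 fz>0

      drop-occurrence : ∀ f x xs P S → Agree f (x ∷ xs) (P ++ x ∷ S) → Agree f xs (P ++ S)
      drop-occurrence f x xs P S same z fz>0 =
        +-cancelˡ-≡ (δ z x) _ _ (trans (same z fz>0) (total-middle (δ z) P x S))

    total-resp-multiplicity : ∀ (f : A → ℕ) xs ys → Agree f xs ys → total f xs ≡ total f ys
    total-resp-multiplicity f [] ys same =
      sym (total-zero ys (λ y y∈ → n≤0⇒n≡0 (≮⇒≥ (λ fy>0 → <-irrefl (same y fy>0) (multiplicity-∈ y∈)))))
    total-resp-multiplicity f (x ∷ xs) ys same with 0 <? f x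
    ... | no fx≯0 = trans (cong (_+ total f xs) (n≤0⇒n≡0 (≮⇒≥ fx≯0)))
                          (total-resp-multiplicity f xs ys (skip-null f x xs ys fx≯0 same))
    ... | yes fx>0 with ∈-∃++ (multiplicity-pos x ys (subst (0 <_) (same x fx>0) (multiplicity-∈ {x} {x ∷ xs} (here refl))))
    ...   | P , S , refl = trans (cong (f x +_) (total-resp-multiplicity f xs (P ++ S) (drop-occurrence f x xs P S same)))
                                 (sym (total-middle f P x S))

module Enumeration where

  open import Data.Nat
  open import Data.Nat.Properties
  open import Data.List using (List; []; _∷_; _++_; [_]; map; concatMap; length; upTo; applyUpTo)
  open import Data.List.Properties using (≡-dec; map-applyUpTo; ∷-injective)
  open import Data.List.Membership.Propositional using (_∈_; _∉_; find)
  open import Data.List.Membership.Propositional.Properties using (∈-∃++; ∈-++⁺ʳ; ∈-map⁻; ∈-concatMap⁻)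
  open import Data.List.Relation.Unary.Any using (here; there)
  open import Data.List.Relation.Unary.All.Properties using (All¬⇒¬Any)
  open import Data.List.Relation.Unary.Unique.Propositional using (Unique; _∷_)
  open import Data.List.Relation.Unary.Unique.Propositional.Properties using (upTo⁺) renaming (map⁺ to unique-map⁺)
  open import Data.List.Relation.Binary.Permutation.Propositional
  open import Data.List.Relation.Binary.Permutation.Propositional.Properties using (∈-resp-↭; ↭-length; drop-mid; ↭-empty-inv)
  open import Relation.Nullary using (yes; no)
  open import Data.Product using (_×_; _,_; proj₁; proj₂)
  open import Data.Empty using (⊥; ⊥-elim)
  open import Function using (id; _∘_)
  open import Relation.Binary.PropositionalEquality as ≡ using (_≡_; _≢_; refl; cong; cong₂; sym; subst)
  open import Data.List.Relation.Binary.Permutation.Setoid.Properties (≡.setoid ℕ) using (Unique-resp-↭)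
  open import Defs using (insertions; permsOf; perms)
  open ListTotals
  open Multiplicity (≡-dec _≟_)

  interval : ℕ → ℕ → List ℕ
  interval lo zero    = []
  interval lo (suc n) = lo ∷ interval (suc lo) n

  applyUpTo≡interval : ∀ (f : ℕ → ℕ) lo n → (∀ i → f i ≡ lo + i) → applyUpTo f n ≡ interval lo n
  applyUpTo≡interval f lo zero    f≡ = refl
  applyUpTo≡interval f lo (suc n) f≡ = cong₂ _∷_ (≡.trans (f≡ 0) (+-identityʳ lo))
    (applyUpTo≡interval (f ∘ suc) (suc lo) n (λ i → ≡.trans (f≡ (suc i)) (+-suc lo i)))

  upTo≡interval : ∀ n → upTo n ≡ interval 0 n
  upTo≡interval n = applyUpTo≡interval id 0 n (λ i → refl)

  alphabet≡interval : ∀ n → map suc (upTo n) ≡ interval 1 n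
  alphabet≡interval n = ≡.trans (map-applyUpTo id suc n) (applyUpTo≡interval suc 1 n (λ i → refl))

  length-interval : ∀ lo n → length (interval lo n) ≡ n
  length-interval lo zero    = refl
  length-interval lo (suc n) = cong suc (length-interval (suc lo) n)

  ∈-interval⁻ : ∀ {x} lo n → x ∈ interval lo n → lo ≤ x × x < lo + n
  ∈-interval⁻ lo (suc n) (here refl) = ≤-refl , subst (lo <_) (sym (+-suc lo n)) (s≤s (m≤m+n lo n))
  ∈-interval⁻ {x} lo (suc n) (there x∈) with ∈-interval⁻ (suc lo) n x∈
  ... | lo<x , x<end = <⇒≤ lo<x , subst (x <_) (sym (+-suc lo n)) x<end

  ∈-interval⁺ : ∀ {x} lo n → lo ≤ x → x < lo + n → x ∈ interval lo n
  ∈-interval⁺ {x} lo zero    lo≤x x<end = ⊥-elim (<⇒≱ x<end (subst (_≤ x) (sym (+-identityʳ lo)) lo≤x))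
  ∈-interval⁺ {x} lo (suc n) lo≤x x<end with lo ≟ x
  ... | yes refl = here refl
  ... | no  lo≢x = there (∈-interval⁺ (suc lo) n (≤∧≢⇒< lo≤x lo≢x) (subst (x <_) (+-suc lo n) x<end))

  interval-++ : ∀ lo a b → interval lo (a + b) ≡ interval lo a ++ interval (lo + a) b
  interval-++ lo zero    b rewrite +-identityʳ lo = refl
  interval-++ lo (suc a) b rewrite interval-++ (suc lo) a b | +-suc lo a = refl

  interval-snoc : ∀ lo n → interval lo (suc n) ≡ interval lo n ++ [ lo + n ]
  interval-snoc lo n = ≡.trans (cong (interval lo) (+-comm 1 n)) (interval-++ lo n 1)

  map-+-interval : ∀ c lo n → map (_+ c) (interval lo n) ≡ interval (lo + c) n
  map-+-interval c lo zero    = refl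
  map-+-interval c lo (suc n) = cong (lo + c ∷_) (map-+-interval c (suc lo) n)

  map-∸-interval : ∀ c lo n → map (_∸ c) (interval (lo + c) n) ≡ interval lo n
  map-∸-interval c lo zero    = refl
  map-∸-interval c lo (suc n) = cong₂ _∷_ (m+n∸n≡m lo c) (map-∸-interval c (suc lo) n)

  unique-alphabet : ∀ n → Unique (map suc (upTo n))
  unique-alphabet n = unique-map⁺ suc-injective (upTo⁺ n)

  unique-resp-↭ : ∀ {xs ys} → xs ↭ ys → Unique xs → Unique ys
  unique-resp-↭ p = Unique-resp-↭ (↭⇒↭ₛ p)

  unique-++-disjoint : ∀ {A : Set} (X Y : List A) {x : A} → Unique (X ++ Y) → x ∈ X → x ∈ Y → ⊥
  unique-++-disjoint (z ∷ X) Y (z∉ ∷ u) (here refl) x∈Y = All¬⇒¬Any z∉ (∈-++⁺ʳ X x∈Y)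
  unique-++-disjoint (z ∷ X) Y (_ ∷ u)  (there x∈X) x∈Y = unique-++-disjoint X Y u x∈X x∈Y

  unique-++ʳ : ∀ {A : Set} (X Y : List A) → Unique (X ++ Y) → Unique Y
  unique-++ʳ []      Y u       = u
  unique-++ʳ (z ∷ X) Y (_ ∷ u) = unique-++ʳ X Y u

  insertions-sound : ∀ a τ σ → σ ∈ insertions a τ → σ ↭ a ∷ τ
  insertions-sound a []       σ (here refl) = refl
  insertions-sound a (b ∷ bs) σ (here refl) = refl
  insertions-sound a (b ∷ bs) σ (there σ∈) with ∈-map⁻ (b ∷_) σ∈
  ... | σ′ , σ′∈ , refl = trans (prep b (insertions-sound a bs σ′ σ′∈)) (swap b a refl)

  permsOf-sound : ∀ xs σ → σ ∈ permsOf xs → σ ↭ xs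
  permsOf-sound []       σ (here refl) = refl
  permsOf-sound (a ∷ as) σ σ∈ with find (∈-concatMap⁻ (insertions a) {xs = permsOf as} σ∈)
  ... | τ , τ∈ , σ∈ins = trans (insertions-sound a τ σ σ∈ins) (prep a (permsOf-sound as τ τ∈))

  δ-∷ : ∀ {x y} σ τ → x ≡ y → δ (x ∷ σ) (y ∷ τ) ≡ δ σ τ
  δ-∷ σ τ refl = δ-resp-⇔ (λ e → proj₂ (∷-injective e)) (cong (_ ∷_))

  δ-∷-head : ∀ {x y} σ τ → x ≢ y → δ (x ∷ σ) (y ∷ τ) ≡ 0
  δ-∷-head σ τ x≢y = δ-≢ (λ e → x≢y (proj₁ (∷-injective e)))

  multiplicity-map-∷ : ∀ {x b} σ L → x ≡ b → multiplicity (x ∷ σ) (map (b ∷_) L) ≡ multiplicity σ L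
  multiplicity-map-∷ σ L x≡b = ≡.trans (total-map _ _ L) (total-cong L (λ τ _ → δ-∷ σ τ x≡b))

  multiplicity-map-∷-≢ : ∀ {x b} σ L → x ≢ b → multiplicity (x ∷ σ) (map (b ∷_) L) ≡ 0
  multiplicity-map-∷-≢ σ L x≢b = ≡.trans (total-map _ _ L) (total-zero L (λ τ _ → δ-∷-head σ τ x≢b))

  multiplicity-insertions : ∀ a P S τ → a ∉ P → a ∉ τ →
    multiplicity (P ++ a ∷ S) (insertions a τ) ≡ δ (P ++ S) τ
  multiplicity-insertions a []      S []       a∉P a∉τ = ≡.trans (+-identityʳ _) (δ-∷ S [] refl)
  multiplicity-insertions a []      S (b ∷ bs) a∉P a∉τ =
    ≡.trans (cong₂ _+_ (δ-∷ S (b ∷ bs) refl) (multiplicity-map-∷-≢ S (insertions a bs) (λ a≡b → a∉τ (here a≡b))))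
            (+-identityʳ _)
  multiplicity-insertions a (p ∷ P) S []       a∉P a∉τ =
    ≡.trans (+-identityʳ _) (≡.trans (δ-∷-head (P ++ a ∷ S) [] p≢a) (sym (δ-≢ (λ ()))))
    where p≢a : p ≢ a
          p≢a p≡a = a∉P (here (sym p≡a))
  multiplicity-insertions a (p ∷ P) S (b ∷ bs) a∉P a∉τ with p ≟ b
  ... | yes refl = cong₂ _+_ (δ-∷-head (P ++ a ∷ S) (b ∷ bs) p≢a)
                     (≡.trans (multiplicity-map-∷ (P ++ a ∷ S) (insertions a bs) refl)
                     (≡.trans (multiplicity-insertions a P S bs (λ a∈P → a∉P (there a∈P)) (λ a∈bs → a∉τ (there a∈bs)))
                              (sym (δ-∷ (P ++ S) bs refl))))
    where p≢a : p ≢ a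
          p≢a p≡a = a∉P (here (sym p≡a))
  ... | no p≢b   = ≡.trans (cong₂ _+_ (δ-∷-head (P ++ a ∷ S) (b ∷ bs) p≢a)
                                      (multiplicity-map-∷-≢ (P ++ a ∷ S) (insertions a bs) p≢b))
                           (sym (δ-∷-head (P ++ S) bs p≢b))
    where p≢a : p ≢ a
          p≢a p≡a = a∉P (here (sym p≡a))

  multiplicity-permsOf : ∀ xs σ → Unique xs → σ ↭ xs → multiplicity σ (permsOf xs) ≡ 1
  multiplicity-permsOf []       σ _           σ↭[] = cong (_+ 0) (δ-≡ (↭-empty-inv σ↭[]))
  multiplicity-permsOf (a ∷ as) σ u@(a∉as ∷ uas) σ↭ with ∈-∃++ (∈-resp-↭ (↭-sym σ↭) (here refl))
  ... | P , S , refl = begin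
    multiplicity (P ++ a ∷ S) (concatMap (insertions a) (permsOf as))
      ≡⟨ total-concatMap (δ (P ++ a ∷ S)) (insertions a) (permsOf as) ⟩
    total (λ τ → multiplicity (P ++ a ∷ S) (insertions a τ)) (permsOf as)
      ≡⟨ total-cong (permsOf as) (λ τ τ∈ → multiplicity-insertions a P S τ a∉P (a∉τ τ τ∈)) ⟩
    multiplicity (P ++ S) (permsOf as)
      ≡⟨ multiplicity-permsOf as (P ++ S) uas (drop-mid P [] σ↭) ⟩
    1 ∎
    where
    open ≡.≡-Reasoning
    a∉P : a ∉ P
    a∉P a∈P = unique-++-disjoint P (a ∷ S) (unique-resp-↭ (↭-sym σ↭) u) a∈P (here refl)
    a∉τ : ∀ τ → τ ∈ permsOf as → a ∉ τ
    a∉τ τ τ∈ a∈τ = All¬⇒¬Any a∉as (∈-resp-↭ (permsOf-sound as τ τ∈) a∈τ)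

  unique-interval : ∀ n → Unique (interval 1 n)
  unique-interval n = subst Unique (alphabet≡interval n) (unique-alphabet n)

  perms-sound : ∀ n σ → σ ∈ perms n → σ ↭ interval 1 n
  perms-sound n σ σ∈ = subst (σ ↭_) (alphabet≡interval n) (permsOf-sound _ σ σ∈)

  multiplicity-perms : ∀ n σ → σ ↭ interval 1 n → multiplicity σ (perms n) ≡ 1
  multiplicity-perms n σ σ↭ =
    multiplicity-permsOf _ σ (unique-alphabet n) (subst (σ ↭_) (sym (alphabet≡interval n)) σ↭)

  length-perms : ∀ {σ} n → σ ∈ perms n → length σ ≡ n
  length-perms {σ} n σ∈ = ≡.trans (↭-length (perms-sound n σ σ∈)) (length-interval 1 n)

  perms-bounds : ∀ {σ x} n → σ ∈ perms n → x ∈ σ → 1 ≤ x × x ≤ n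
  perms-bounds {σ} n σ∈ x∈ with ∈-interval⁻ 1 n (∈-resp-↭ (perms-sound n σ σ∈) x∈)
  ... | 1≤x , x<1+n = 1≤x , ≤-pred x<1+n

module Pattern132 where

  open import Data.Nat
  open import Data.Nat.Properties
  open import Data.Bool using (Bool; true; false; if_then_else_; _∧_; _∨_; not; T)
  open import Data.Bool.Properties using (∨-assoc; ∨-identityʳ; ∨-zeroʳ; ∧-zeroʳ)
  open import Data.Unit using (tt)
  open import Data.List using (List; []; _∷_; _++_; [_]; map; length)
  open import Data.List.Properties using (++-assoc; ++-identityʳ)
  open import Data.List.Membership.Propositional using (_∈_)
  open import Data.List.Membership.Propositional.Properties using (∈-∃++; ∈-++⁺ʳ)
  open import Data.List.Relation.Unary.Any using (here; there)
  open import Data.List.Relation.Unary.All as All using (All; []; _∷_)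
  open import Data.List.Relation.Unary.All.Properties using () renaming (++⁺ to All-++⁺)
  open import Data.Product using (_,_)
  open import Data.Empty using (⊥-elim)
  open import Relation.Binary.PropositionalEquality hiding ([_])
  open import Defs
  open ≡-Reasoning

  <ᵇ-true : ∀ {x y} → x < y → (x <ᵇ y) ≡ true
  <ᵇ-true {x} {y} x<y with x <ᵇ y | <⇒<ᵇ x<y
  ... | true | _ = refl

  <ᵇ-false : ∀ {x y} → y ≤ x → (x <ᵇ y) ≡ false
  <ᵇ-false {x} {y} y≤x with x <ᵇ y in eq
  ... | false = refl
  ... | true  = ⊥-elim (<⇒≱ (<ᵇ⇒< x y (subst T (sym eq) tt)) y≤x)

  <ᵇ-+ : ∀ x y b → ((x + b) <ᵇ (y + b)) ≡ (x <ᵇ y)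
  <ᵇ-+ x y zero    rewrite +-identityʳ x | +-identityʳ y = refl
  <ᵇ-+ x y (suc b) rewrite +-suc x b | +-suc y b = <ᵇ-+ x y b

  anyᵇ-++ : ∀ p xs ys → anyᵇ p (xs ++ ys) ≡ anyᵇ p xs ∨ anyᵇ p ys
  anyᵇ-++ p []       ys = refl
  anyᵇ-++ p (x ∷ xs) ys rewrite anyᵇ-++ p xs ys = sym (∨-assoc (p x) _ _)

  anyᵇ-false : ∀ p xs → All (λ x → p x ≡ false) xs → anyᵇ p xs ≡ false
  anyᵇ-false p []       []           = refl
  anyᵇ-false p (x ∷ xs) (px ∷ pxs) rewrite px = anyᵇ-false p xs pxs

  anyᵇ-true : ∀ p xs {x} → x ∈ xs → p x ≡ true → anyᵇ p xs ≡ true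
  anyᵇ-true p (y ∷ xs) (here refl) px rewrite px = refl
  anyᵇ-true p (y ∷ xs) (there x∈) px rewrite anyᵇ-true p xs x∈ px = ∨-zeroʳ (p y)

  anyᵇ-map : ∀ p f xs → anyᵇ p (map f xs) ≡ anyᵇ (λ x → p (f x)) xs
  anyᵇ-map p f []       = refl
  anyᵇ-map p f (x ∷ xs) rewrite anyᵇ-map p f xs = refl

  anyᵇ-cong : ∀ p q xs → (∀ x → p x ≡ q x) → anyᵇ p xs ≡ anyᵇ q xs
  anyᵇ-cong p q []       eq = refl
  anyᵇ-cong p q (x ∷ xs) eq = cong₂ _∨_ (eq x) (anyᵇ-cong p q xs eq)

  between : ℕ → ℕ → ℕ → Bool
  between x b c = (x <ᵇ c) ∧ (c <ᵇ b)

  none-above : ∀ x B (q : ℕ → Bool) → All (_< x) B → anyᵇ (λ c → (x <ᵇ c) ∧ q c) B ≡ false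
  none-above x B q B<x = anyᵇ-false _ B (All.map (λ {c} c<x → cong (_∧ q c) (<ᵇ-false (<⇒≤ c<x))) B<x)

  has21Above-below : ∀ x B → All (_≤ x) B → has21Above x B ≡ false
  has21Above-below x []      []             = refl
  has21Above-below x (b ∷ B) (b≤x ∷ B≤x) rewrite <ᵇ-false {x} {b} b≤x = has21Above-below x B B≤x

  has21Above-++ : ∀ x Y Z → has21Above x Z ≡ false → All (λ b → anyᵇ (between x b) Z ≡ false) Y →
    has21Above x (Y ++ Z) ≡ has21Above x Y
  has21Above-++ x []      Z noneZ []             = noneZ
  has21Above-++ x (b ∷ Y) Z noneZ (noneb ∷ nones)
    rewrite anyᵇ-++ (between x b) Y Z | noneb | ∨-identityʳ (anyᵇ (between x b) Y)
          | has21Above-++ x Y Z noneZ nones = refl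

  record Stacked (A : List ℕ) (N : ℕ) (B : List ℕ) : Set where
    field
      A<N : All (_< N) A
      B<N : All (_< N) B
      B<A : All (λ a → All (_< a) B) A
  open Stacked

  contains132-stacked : ∀ A N B → Stacked A N B → contains132 (A ++ N ∷ B) ≡ contains132 A ∨ contains132 B
  contains132-stacked []      N B s rewrite has21Above-below N B (All.map <⇒≤ (B<N s)) = refl
  contains132-stacked (x ∷ A) N B s =
    trans (cong₂ _∨_ (has21Above-++ x A (N ∷ B) none-in-tail none-across) (contains132-stacked A N B s′))
          (sym (∨-assoc (has21Above x A) _ _))
    where
    B<x : All (_< x) B
    B<x = All.head (B<A s)
    s′ : Stacked A N B
    s′ = record { A<N = All.tail (A<N s) ; B<N = B<N s ; B<A = All.tail (B<A s) }
    -- B lies below x and N above everything, so x starts no 132 inside N ∷ B …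
    none-in-tail : has21Above x (N ∷ B) ≡ false
    none-in-tail rewrite none-above x B (_<ᵇ N) B<x | ∧-zeroʳ (x <ᵇ N) = has21Above-below x B (All.map <⇒≤ B<x)
    -- … nor with a "3" in A and a "2" in N ∷ B.
    none-across : All (λ b → anyᵇ (between x b) (N ∷ B) ≡ false) A
    none-across = All.map (λ {b} b<N → trans (cong (λ t → ((x <ᵇ N) ∧ t) ∨ anyᵇ (between x b) B) (<ᵇ-false (<⇒≤ b<N)))
                                          (trans (cong (_∨ anyᵇ (between x b) B) (∧-zeroʳ (x <ᵇ N)))
                                                 (none-above x B (_<ᵇ b) B<x)))
                          (All.tail (A<N s))

  contains132-suffix : ∀ P Q → contains132 Q ≡ true → contains132 (P ++ Q) ≡ true
  contains132-suffix []      Q c = c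
  contains132-suffix (x ∷ P) Q c rewrite contains132-suffix P Q c = ∨-zeroʳ _

  has21Above-witness : ∀ x Y b Z {c} → x < b → c ∈ Z → x < c → c < b → has21Above x (Y ++ b ∷ Z) ≡ true
  has21Above-witness x []      b Z x<b c∈Z x<c c<b
    rewrite <ᵇ-true x<b | anyᵇ-true (between x b) Z c∈Z (cong₂ _∧_ (<ᵇ-true x<c) (<ᵇ-true c<b)) = refl
  has21Above-witness x (y ∷ Y) b Z x<b c∈Z x<c c<b
    rewrite has21Above-witness x Y b Z x<b c∈Z x<c c<b = ∨-zeroʳ _

  contains132-witness : ∀ P N S {x y} → x ∈ P → y ∈ S → x < y → y < N → contains132 (P ++ N ∷ S) ≡ true
  contains132-witness P N S {x} {y} x∈P y∈S x<y y<N with ∈-∃++ x∈P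
  ... | P₁ , P₂ , refl rewrite ++-assoc P₁ (x ∷ P₂) (N ∷ S) =
    contains132-suffix P₁ (x ∷ P₂ ++ N ∷ S)
      (cong (_∨ contains132 (P₂ ++ N ∷ S)) (has21Above-witness x P₂ N S (<-trans x<y y<N) y∈S x<y y<N))

  module _ (b : ℕ) where

    has21Above-shift : ∀ x cs → has21Above (x + b) (map (_+ b) cs) ≡ has21Above x cs
    has21Above-shift x []       = refl
    has21Above-shift x (c ∷ cs) rewrite has21Above-shift x cs | <ᵇ-+ x c b
      | anyᵇ-map (between (x + b) (c + b)) (_+ b) cs
      | anyᵇ-cong (λ z → between (x + b) (c + b) (z + b)) (between x c) cs
                  (λ z → cong₂ _∧_ (<ᵇ-+ x z b) (<ᵇ-+ z c b)) = refl

    contains132-shift : ∀ σ → contains132 (map (_+ b) σ) ≡ contains132 σ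
    contains132-shift []      = refl
    contains132-shift (x ∷ σ) rewrite has21Above-shift x σ | contains132-shift σ = refl

  countᵇ-++ : ∀ p xs ys → countᵇ p (xs ++ ys) ≡ countᵇ p xs + countᵇ p ys
  countᵇ-++ p []       ys = refl
  countᵇ-++ p (x ∷ xs) ys rewrite countᵇ-++ p xs ys = sym (+-assoc (if p x then 1 else 0) _ _)

  countᵇ-all : ∀ p xs → All (λ x → p x ≡ true) xs → countᵇ p xs ≡ length xs
  countᵇ-all p []       []           = refl
  countᵇ-all p (x ∷ xs) (px ∷ pxs) rewrite px = cong suc (countᵇ-all p xs pxs)

  countᵇ-none : ∀ p xs → All (λ x → p x ≡ false) xs → countᵇ p xs ≡ 0
  countᵇ-none p []       []           = refl
  countᵇ-none p (x ∷ xs) (px ∷ pxs) rewrite px = countᵇ-none p xs pxs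

  -- Entries of A are followed by the larger N, so they are never counted.
  mmpGo-before-max : ∀ k pre A N B → All (_< N) A → mmpGo k pre (A ++ N ∷ B) ≡ mmpGo k (pre ++ A) (N ∷ B)
  mmpGo-before-max k pre []      N B []           rewrite ++-identityʳ pre = refl
  mmpGo-before-max k pre (x ∷ A) N B (x<N ∷ A<N)
    rewrite anyᵇ-true (x <ᵇ_) (A ++ N ∷ B) (∈-++⁺ʳ A (here refl)) (<ᵇ-true x<N)
          | mmpGo-before-max k (pre ++ x ∷ []) A N B A<N | ++-assoc pre (x ∷ []) A = refl

  mmpGo-dominated-prefix : ∀ k P Q B → All (λ p → All (_≤ p) B) P → mmpGo k (P ++ Q) B ≡ mmpGo k Q B
  mmpGo-dominated-prefix k P Q []      P≥B = refl
  mmpGo-dominated-prefix k P Q (y ∷ B) P≥B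
    rewrite countᵇ-++ (_<ᵇ y) P Q
          | countᵇ-none (_<ᵇ y) P (All.map (λ y≤p → <ᵇ-false (All.head y≤p)) P≥B)
          | ++-assoc P Q (y ∷ [])
          | mmpGo-dominated-prefix k P (Q ++ y ∷ []) B (All.map All.tail P≥B) = refl

  mmp-stacked : ∀ k A N B → Stacked A N B → mmp k (A ++ N ∷ B) ≡ (if k ≤ᵇ length A then 1 else 0) + mmp k B
  mmp-stacked k A N B s = begin
    mmpGo k [] (A ++ N ∷ B)
      ≡⟨ mmpGo-before-max k [] A N B (A<N s) ⟩
    (if not (anyᵇ (N <ᵇ_) B) ∧ (k ≤ᵇ countᵇ (_<ᵇ N) A) then 1 else 0) + mmpGo k (A ++ [ N ]) B
      ≡⟨ cong₂ (λ t c → (if not t ∧ (k ≤ᵇ c) then 1 else 0) + mmpGo k (A ++ [ N ]) B)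
               (anyᵇ-false (N <ᵇ_) B (All.map (λ y<N → <ᵇ-false (<⇒≤ y<N)) (B<N s)))
               (countᵇ-all (_<ᵇ N) A (All.map <ᵇ-true (A<N s))) ⟩
    (if k ≤ᵇ length A then 1 else 0) + mmpGo k (A ++ [ N ]) B
      ≡⟨ cong (λ P → (if k ≤ᵇ length A then 1 else 0) + mmpGo k P B) (sym (++-identityʳ (A ++ [ N ]))) ⟩
    (if k ≤ᵇ length A then 1 else 0) + mmpGo k ((A ++ [ N ]) ++ []) B
      ≡⟨ cong ((if k ≤ᵇ length A then 1 else 0) +_) (mmpGo-dominated-prefix k (A ++ [ N ]) [] B A,N≥B) ⟩
    (if k ≤ᵇ length A then 1 else 0) + mmpGo k [] B
      ∎
    where
    A,N≥B : All (λ p → All (_≤ p) B) (A ++ [ N ])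
    A,N≥B = All-++⁺ (All.map (All.map <⇒≤) (B<A s)) (All.map <⇒≤ (B<N s) ∷ [])

module Decomposition where

  open import Data.Nat
  open import Data.Nat.Properties
  open import Data.Bool using (true; false)
  open import Data.List using (List; []; _∷_; _++_; [_]; map; concatMap; length; upTo; filter)
  open import Data.List.Properties
    using (≡-dec; ++-identityʳ; length-++; length-map; ∷-injective; filter-++; filter-all; filter-none; filter-accept; filter-reject)
  open import Data.List.Membership.Propositional using (_∈_; _∉_; find)
  open import Data.List.Membership.Propositional.Properties using (∈-∃++; ∈-++⁺ˡ; ∈-++⁺ʳ; ∈-map⁻; ∈-concatMap⁻)
  open import Data.List.Membership.DecPropositional (≡-dec _≟_) using (_∈?_)
  open import Data.List.Relation.Unary.Any using (here; there)
  open import Data.List.Relation.Unary.All as All using (All; []; _∷_)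
  open import Data.List.Relation.Unary.All.Properties using (All¬⇒¬Any)
  open import Data.List.Relation.Unary.Unique.Propositional using (Unique; _∷_)
  open import Data.List.Relation.Unary.Unique.Propositional.Properties using (upTo⁺)
  open import Data.List.Relation.Binary.Permutation.Propositional
  open import Data.List.Relation.Binary.Permutation.Propositional.Properties
    using (∈-resp-↭; ↭-length; map⁺; filter-↭; ∷↭∷ʳ; ++-comm; ++⁺ˡ; ++⁺ʳ; drop-∷)
  open import Data.List.Extrema.Nat using (max; xs≤max; max<v⁺)
  open import Data.Product using (_×_; _,_; proj₁; proj₂)
  open import Data.Sum using (inj₁; inj₂)
  open import Data.Empty using (⊥; ⊥-elim)
  open import Relation.Nullary using (yes; no)
  open import Relation.Binary.Definitions using (tri<; tri≈; tri>)
  open import Relation.Binary.PropositionalEquality as ≡ using (_≡_; _≢_; refl; cong; cong₂; sym; subst; subst₂)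
  open import Defs using (perms; contains132)
  open ListTotals
  open Enumeration
  open Pattern132
  open Multiplicity (≡-dec _≟_)
  module Index = Multiplicity _≟_

  glue : ℕ → ℕ → List ℕ → List ℕ → List ℕ
  glue n a α β = map (_+ (n ∸ a)) α ++ suc n ∷ β

  stackingsAt : ℕ → ℕ → List (List ℕ)
  stackingsAt n a = concatMap (λ α → map (glue n a α) (perms (n ∸ a))) (perms a)

  stackings : ℕ → List (List ℕ)
  stackings n = concatMap (stackingsAt n) (upTo (suc n))

  upTo-bound : ∀ {a} n → a ∈ upTo (suc n) → a ≤ n
  upTo-bound {a} n a∈ = ≤-pred (proj₂ (∈-interval⁻ 0 (suc n) (subst (a ∈_) (upTo≡interval (suc n)) a∈)))

  glue-perm : ∀ a b α β → α ↭ interval 1 a → β ↭ interval 1 b →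
    map (_+ b) α ++ suc (a + b) ∷ β ↭ interval 1 (suc (a + b))
  glue-perm a b α β α↭ β↭ =
    trans (trans (++-comm (map (_+ b) α) (N ∷ β)) (∷↭∷ʳ N (β ++ map (_+ b) α)))
          (subst ((β ++ map (_+ b) α) ++ [ N ] ↭_) (sym blocks)
                 (++⁺ʳ [ N ] (trans (++⁺ˡ β shifted-α↭) (++⁺ʳ _ β↭))))
    where
    N : ℕ
    N = suc (a + b)
    shifted-α↭ : map (_+ b) α ↭ interval (suc b) a
    shifted-α↭ = subst (map (_+ b) α ↭_) (map-+-interval b 1 a) (map⁺ (_+ b) α↭)
    blocks : interval 1 N ≡ (interval 1 b ++ interval (suc b) a) ++ [ N ]
    blocks = ≡.trans (interval-snoc 1 (a + b))
               (cong (_++ [ N ]) (≡.trans (cong (interval 1) (+-comm a b)) (interval-++ 1 b a)))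

  glue-↭ : ∀ n a α β → a ≤ n → α ∈ perms a → β ∈ perms (n ∸ a) → glue n a α β ↭ interval 1 (suc n)
  glue-↭ n a α β a≤n α∈ β∈ = subst (λ m → map (_+ (n ∸ a)) α ++ suc m ∷ β ↭ interval 1 (suc m)) (m+[n∸m]≡n a≤n)
    (glue-perm a (n ∸ a) α β (perms-sound a α α∈) (perms-sound (n ∸ a) β β∈))

  stackings-sound : ∀ n σ → σ ∈ stackings n → σ ↭ interval 1 (suc n)
  stackings-sound n σ σ∈ with find (∈-concatMap⁻ (stackingsAt n) {xs = upTo (suc n)} σ∈)
  ... | a , a∈ , σ∈a with find (∈-concatMap⁻ (λ α → map (glue n a α) (perms (n ∸ a))) {xs = perms a} σ∈a)
  ...   | α , α∈ , σ∈α with ∈-map⁻ (glue n a α) σ∈α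
  ...     | β , β∈ , refl = glue-↭ n a α β (upTo-bound n a∈) α∈ β∈

  glue-stacked : ∀ n a α β → a ≤ n → α ∈ perms a → β ∈ perms (n ∸ a) →
    Stacked (map (_+ (n ∸ a)) α) (suc n) β
  glue-stacked n a α β a≤n α∈ β∈ = record
    { A<N = All.tabulate λ x∈ → shifted-bound x∈
    ; B<N = All.tabulate λ y∈ → s≤s (≤-trans (proj₂ (perms-bounds b β∈ y∈)) (m∸n≤m n a))
    ; B<A = All.tabulate λ x∈ → All.tabulate λ y∈ → β-below x∈ y∈ }
    where
    b : ℕ
    b = n ∸ a
    shifted-bound : ∀ {z} → z ∈ map (_+ b) α → z < suc n
    shifted-bound z∈ with ∈-map⁻ (_+ b) z∈
    ... | x , x∈ , refl = s≤s (subst (x + b ≤_) (m+[n∸m]≡n a≤n) (+-monoˡ-≤ b (proj₂ (perms-bounds a α∈ x∈))))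
    β-below : ∀ {z y} → z ∈ map (_+ b) α → y ∈ β → y < z
    β-below z∈ y∈ with ∈-map⁻ (_+ b) z∈
    ... | x , x∈ , refl = ≤-trans (s≤s (proj₂ (perms-bounds b β∈ y∈)))
                                  (+-monoˡ-≤ b (proj₁ (perms-bounds a α∈ x∈)))

  split-unique : ∀ (Q Q′ : List ℕ) N S S′ → N ∉ Q → N ∉ Q′ → Q ++ N ∷ S ≡ Q′ ++ N ∷ S′ → Q ≡ Q′ × S ≡ S′
  split-unique []      []       N S S′ _ _ eq = refl , proj₂ (∷-injective eq)
  split-unique []      (x ∷ Q′) N S S′ _ N∉Q′ eq = ⊥-elim (N∉Q′ (here (proj₁ (∷-injective eq))))
  split-unique (x ∷ Q) []       N S S′ N∉Q _ eq = ⊥-elim (N∉Q (here (sym (proj₁ (∷-injective eq)))))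
  split-unique (x ∷ Q) (y ∷ Q′) N S S′ N∉Q N∉Q′ eq with ∷-injective eq
  ... | refl , eq′ with split-unique Q Q′ N S S′ (λ N∈ → N∉Q (there N∈)) (λ N∈ → N∉Q′ (there N∈)) eq′
  ...   | refl , refl = refl , refl

  N∉left-block : ∀ n a α → α ∈ perms a → a ≤ n → suc n ∉ map (_+ (n ∸ a)) α
  N∉left-block n a α α∈ a≤n N∈ with ∈-map⁻ (_+ (n ∸ a)) N∈
  ... | x , x∈ , N≡ = <⇒≢ (s≤s x+b≤n) (sym N≡)
    where x+b≤n : x + (n ∸ a) ≤ n
          x+b≤n = subst (x + (n ∸ a) ≤_) (m+[n∸m]≡n a≤n) (+-monoˡ-≤ (n ∸ a) (proj₂ (perms-bounds a α∈ x∈)))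

  module SplitAvoider (n : ℕ) (P S : List ℕ) (avoids : contains132 (P ++ suc n ∷ S) ≡ false)
                      (σ↭ : P ++ suc n ∷ S ↭ interval 1 (suc n)) where

    private
      N : ℕ
      N = suc n
      σ : List ℕ
      σ = P ++ N ∷ S

      unique-σ : Unique σ
      unique-σ = unique-resp-↭ (↭-sym σ↭) (unique-interval N)

      bounds : ∀ {x} → x ∈ σ → 1 ≤ x × x < 1 + N
      bounds x∈ = ∈-interval⁻ 1 N (∈-resp-↭ σ↭ x∈)

      below-N : ∀ {x} → x ∈ σ → x ≢ N → x < N
      below-N x∈ x≢N = ≤∧≢⇒< (≤-pred (proj₂ (bounds x∈))) x≢N

    N∉P : N ∉ P
    N∉P N∈ = unique-++-disjoint P (N ∷ S) unique-σ N∈ (here refl)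

    private
      N∉S : N ∉ S
      N∉S N∈ with unique-++ʳ P (N ∷ S) unique-σ
      ... | N∉ ∷ _ = All¬⇒¬Any N∉ N∈

      S<N : ∀ {y} → y ∈ S → y < N
      S<N y∈ = below-N (∈-++⁺ʳ P (there y∈)) (λ { refl → N∉S y∈ })

      -- Avoidance forces every entry of P above every entry of S.
      S<P : ∀ {x y} → x ∈ P → y ∈ S → y < x
      S<P {x} {y} x∈ y∈ with <-cmp x y
      ... | tri< x<y _ _  = ⊥-elim (true≢false (≡.trans (sym (contains132-witness P N S x∈ y∈ x<y (S<N y∈))) avoids))
        where true≢false : true ≢ false
              true≢false ()
      ... | tri≈ _ refl _ = ⊥-elim (unique-++-disjoint P (N ∷ S) unique-σ x∈ (there y∈))
      ... | tri> _ _ y<x  = y<x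

      M : ℕ
      M = max 0 S

      M<P : ∀ {x} → x ∈ P → M < x
      M<P x∈ = max<v⁺ (proj₁ (bounds (∈-++⁺ˡ x∈))) (All.tabulate (S<P x∈))

      M<N : M < N
      M<N = max<v⁺ (s≤s z≤n) (All.tabulate S<N)

      low-σ : filter (_≤? M) σ ≡ S
      low-σ = ≡.trans (filter-++ (_≤? M) P (N ∷ S))
        (cong₂ _++_ (filter-none (_≤? M) (All.tabulate (λ x∈ → <⇒≱ (M<P x∈))))
                    (≡.trans (filter-reject (_≤? M) (<⇒≱ M<N)) (filter-all (_≤? M) (xs≤max 0 S))))

      high-σ : filter (M <?_) σ ≡ P ++ [ N ]
      high-σ = ≡.trans (filter-++ (M <?_) P (N ∷ S))
        (cong₂ _++_ (filter-all (M <?_) (All.tabulate M<P))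
                    (≡.trans (filter-accept (M <?_) M<N) (cong (N ∷_) (filter-none (M <?_) (All.map ≤⇒≯ (xs≤max 0 S))))))

      in-interval : ∀ {Q : ℕ → Set} lo k → (∀ {x} → lo ≤ x → x < lo + k → Q x) → All Q (interval lo k)
      in-interval lo k q = All.tabulate (λ x∈ → let b = ∈-interval⁻ lo k x∈ in q (proj₁ b) (proj₂ b))

      split-interval : interval 1 N ≡ interval 1 M ++ interval (suc M) (N ∸ M)
      split-interval = ≡.trans (cong (interval 1) (sym (m+[n∸m]≡n (<⇒≤ M<N)))) (interval-++ 1 M (N ∸ M))

      low-interval : filter (_≤? M) (interval 1 N) ≡ interval 1 M
      low-interval = ≡.trans (cong (filter (_≤? M)) split-interval) (≡.trans (filter-++ (_≤? M) (interval 1 M) _)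
        (≡.trans (cong₂ _++_ (filter-all (_≤? M) (in-interval 1 M (λ _ x<1+M → ≤-pred x<1+M)))
                             (filter-none (_≤? M) (in-interval (suc M) (N ∸ M) (λ M<x _ → <⇒≱ M<x))))
                 (++-identityʳ _)))

      high-interval : filter (M <?_) (interval 1 N) ≡ interval (suc M) (n ∸ M) ++ [ N ]
      high-interval = ≡.trans (cong (filter (M <?_)) split-interval) (≡.trans (filter-++ (M <?_) (interval 1 M) _)
        (≡.trans (cong₂ _++_ (filter-none (M <?_) (in-interval 1 M (λ _ x<1+M → ≤⇒≯ (≤-pred x<1+M))))
                             (filter-all (M <?_) (in-interval (suc M) (N ∸ M) (λ M<x _ → M<x))))
                 top-separated))
        where
        top-separated : interval (suc M) (N ∸ M) ≡ interval (suc M) (n ∸ M) ++ [ N ]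
        top-separated = ≡.trans (cong (interval (suc M)) (+-∸-assoc 1 (≤-pred M<N)))
          (≡.trans (interval-snoc (suc M) (n ∸ M)) (cong (λ m → interval (suc M) (n ∸ M) ++ [ suc m ]) (m+[n∸m]≡n (≤-pred M<N))))

      S↭ : S ↭ interval 1 M
      S↭ = subst₂ _↭_ low-σ low-interval (filter-↭ (_≤? M) σ↭)

      P↭ : P ↭ interval (suc M) (n ∸ M)
      P↭ = drop-∷ (trans (∷↭∷ʳ N P) (trans (subst₂ _↭_ high-σ high-interval (filter-↭ (M <?_) σ↭))
                                            (↭-sym (∷↭∷ʳ N (interval (suc M) (n ∸ M))))))

      |S|≡M : length S ≡ M
      |S|≡M = ≡.trans (↭-length S↭) (length-interval 1 M)

      |P|≡n∸M : length P ≡ n ∸ M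
      |P|≡n∸M = ≡.trans (↭-length P↭) (length-interval (suc M) (n ∸ M))

    low-block : S ↭ interval 1 (length S)
    low-block rewrite |S|≡M = S↭

    high-block : P ↭ interval (suc (length S)) (length P)
    high-block rewrite |S|≡M | |P|≡n∸M = P↭

    high-above : All (length S <_) P
    high-above rewrite |S|≡M = All.tabulate M<P

  map-+-∸ : ∀ b (Q : List ℕ) → All (b <_) Q → map (_+ b) (map (_∸ b) Q) ≡ Q
  map-+-∸ b []      []           = refl
  map-+-∸ b (x ∷ Q) (b<x ∷ b<Q) = cong₂ _∷_ (m∸n+n≡m (<⇒≤ b<x)) (map-+-∸ b Q b<Q)

  map-∸-+ : ∀ b (Q : List ℕ) → map (_∸ b) (map (_+ b) Q) ≡ Q
  map-∸-+ b []      = refl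
  map-∸-+ b (x ∷ Q) = cong₂ _∷_ (m+n∸n≡m x b) (map-∸-+ b Q)

  multiplicity-stackingsAt : ∀ n a σ →
    multiplicity σ (stackingsAt n a) ≡ total (λ α → total (λ β → δ σ (glue n a α β)) (perms (n ∸ a))) (perms a)
  multiplicity-stackingsAt n a σ =
    ≡.trans (total-concatMap (δ σ) (λ α → map (glue n a α) (perms (n ∸ a))) (perms a))
            (total-cong (perms a) (λ α _ → total-map (δ σ) (glue n a α) (perms (n ∸ a))))

  module _ (n : ℕ) (P S : List ℕ) (avoids : contains132 (P ++ suc n ∷ S) ≡ false)
           (σ↭ : P ++ suc n ∷ S ↭ interval 1 (suc n)) where

    open SplitAvoider n P S avoids σ↭

    private
      σ : List ℕ
      σ = P ++ suc n ∷ S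
      i c : ℕ
      i = length P
      c = n ∸ i

      i+|S|≡n : i + length S ≡ n
      i+|S|≡n = suc-injective (≡.trans (sym (+-suc i (length S)))
                              (≡.trans (sym (length-++ P)) (≡.trans (↭-length σ↭) (length-interval 1 (suc n)))))

      c≡|S| : c ≡ length S
      c≡|S| = ≡.trans (cong (_∸ i) (sym i+|S|≡n)) (m+n∸m≡n i (length S))

      i≤n : i ≤ n
      i≤n = subst (i ≤_) i+|S|≡n (m≤m+n i (length S))

      α : List ℕ
      α = map (_∸ c) P

      α↭ : α ↭ interval 1 i
      α↭ = subst (α ↭_) (map-∸-interval c 1 i)
                 (map⁺ (_∸ c) (subst (λ m → P ↭ interval (suc m) i) (sym c≡|S|) high-block))

      S↭ : S ↭ interval 1 c
      S↭ = subst (λ m → S ↭ interval 1 m) (sym c≡|S|) low-block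

      shift-α : map (_+ c) α ≡ P
      shift-α = map-+-∸ c P (subst (λ m → All (m <_) P) (sym c≡|S|) high-above)

      δ-glue : ∀ α′ β′ → α′ ∈ perms i → δ σ (glue n i α′ β′) ≡ δ α α′ * δ S β′
      δ-glue α′ β′ α′∈ = δ-product to from
        where
        to : σ ≡ glue n i α′ β′ → α ≡ α′ × S ≡ β′
        to eq with split-unique P (map (_+ c) α′) (suc n) S β′ N∉P (N∉left-block n i α′ α′∈ i≤n) eq
        ... | P≡ , S≡ = ≡.trans (cong (map (_∸ c)) P≡) (map-∸-+ c α′) , S≡
        from : α ≡ α′ → S ≡ β′ → σ ≡ glue n i α′ β′
        from refl refl = cong (_++ suc n ∷ S) (sym shift-α)

      at-size-i : multiplicity σ (stackingsAt n i) ≡ 1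
      at-size-i = begin
        multiplicity σ (stackingsAt n i)
          ≡⟨ multiplicity-stackingsAt n i σ ⟩
        total (λ α′ → total (λ β′ → δ σ (glue n i α′ β′)) (perms c)) (perms i)
          ≡⟨ total-cong (perms i) (λ α′ α′∈ → ≡.trans (total-cong (perms c) (λ β′ _ → δ-glue α′ β′ α′∈))
                                                      (total-*ˡ (δ α α′) (δ S) (perms c))) ⟩
        total (λ α′ → δ α α′ * multiplicity S (perms c)) (perms i)
          ≡⟨ total-*ʳ (multiplicity S (perms c)) (δ α) (perms i) ⟩
        multiplicity α (perms i) * multiplicity S (perms c)
          ≡⟨ cong₂ _*_ (multiplicity-perms i α α↭) (multiplicity-perms c S S↭) ⟩
        1 ∎
        where open ≡.≡-Reasoning

      at-other-size : ∀ a → a ≢ i → a ≤ n → multiplicity σ (stackingsAt n a) ≡ 0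
      at-other-size a a≢i a≤n = ≡.trans (multiplicity-stackingsAt n a σ)
        (total-zero (perms a) λ α′ α′∈ → total-zero (perms (n ∸ a)) λ β′ _ → δ-≢ λ eq →
          a≢i (≡.trans (sym (length-perms a α′∈)) (≡.trans (sym (length-map (_+ (n ∸ a)) α′))
            (cong length (sym (proj₁ (split-unique P (map (_+ (n ∸ a)) α′) (suc n) S β′ N∉P
                                                   (N∉left-block n a α′ α′∈ a≤n) eq)))))))

    multiplicity-split-avoider : multiplicity σ (stackings n) ≡ 1
    multiplicity-split-avoider = begin
      multiplicity σ (stackings n)                                   ≡⟨ total-concatMap (δ σ) (stackingsAt n) (upTo (suc n)) ⟩
      total (λ a → multiplicity σ (stackingsAt n a)) (upTo (suc n))  ≡⟨ total-cong (upTo (suc n)) by-size ⟩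
      Index.multiplicity i (upTo (suc n))                            ≡⟨ Index.multiplicity-unique (upTo⁺ (suc n)) i∈ ⟩
      1                                                              ∎
      where
      open ≡.≡-Reasoning
      by-size : ∀ a → a ∈ upTo (suc n) → multiplicity σ (stackingsAt n a) ≡ Index.δ i a
      by-size a a∈ with Index.δ-view i a
      ... | inj₁ (refl , d) = ≡.trans at-size-i (sym d)
      ... | inj₂ (i≢a , d)  = ≡.trans (at-other-size a (λ a≡i → i≢a (sym a≡i)) (upTo-bound n a∈)) (sym d)
      i∈ : i ∈ upTo (suc n)
      i∈ = subst (i ∈_) (sym (upTo≡interval (suc n))) (∈-interval⁺ 0 (suc n) z≤n (s≤s i≤n))

  multiplicity-stackings : ∀ n σ → contains132 σ ≡ false →
    multiplicity σ (stackings n) ≡ multiplicity σ (perms (suc n))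
  multiplicity-stackings n σ avoids with σ ∈? perms (suc n)
  ... | yes σ∈ = ≡.trans (avoider-once σ↭) (sym (multiplicity-perms (suc n) σ σ↭))
    where
    σ↭ : σ ↭ interval 1 (suc n)
    σ↭ = perms-sound (suc n) σ σ∈
    avoider-once : σ ↭ interval 1 (suc n) → multiplicity σ (stackings n) ≡ 1
    avoider-once σ↭ with ∈-∃++ (∈-resp-↭ (↭-sym σ↭) (∈-interval⁺ 1 (suc n) (s≤s z≤n) ≤-refl))
    ... | P , S , refl = multiplicity-split-avoider n P S avoids σ↭
  ... | no σ∉ = ≡.trans (multiplicity-∉ σ (stackings n) σ∉stackings) (sym (multiplicity-∉ σ (perms (suc n)) σ∉))
    where
    σ∉stackings : σ ∉ stackings n
    σ∉stackings σ∈ = σ∉ (multiplicity-pos σ (perms (suc n))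
      (subst (0 <_) (sym (multiplicity-perms (suc n) σ (stackings-sound n σ σ∈))) (s≤s z≤n)))

module Recurrence where

  open import Data.Nat
  open import Data.Nat.Properties
  open import Data.Bool using (Bool; true; false; if_then_else_; _∧_; not)
  open import Data.Bool.Properties using (∧-zeroʳ)
  open import Data.List using (List; _∷_; []; map; upTo)
  open import Data.List.Properties using (≡-dec; length-map)
  open import Data.List.Membership.Propositional using (_∈_)
  open import Data.Sum using (inj₁; inj₂)
  open import Relation.Nullary using (contradiction)
  open import Relation.Binary.PropositionalEquality
  open import Defs
  open CatalanNumbers
  open ListTotals
  open Enumeration
  open Pattern132
  open Decomposition
  open Multiplicity (≡-dec _≟_)

  weight : ℕ → (ℕ → Bool) → List ℕ → ℕ
  weight k q σ = if not (contains132 σ) ∧ q (mmp k σ) then 1 else 0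

  -- Contribution [k ≤ a] of the maximum n+1 to mmp when the left block has size a.
  bonus : ℕ → ℕ → ℕ
  bonus k a = if k ≤ᵇ a then 1 else 0

  weight-glue : ∀ k q n a α β → a ≤ n → α ∈ perms a → β ∈ perms (n ∸ a) →
    weight k q (glue n a α β) ≡ weight k (λ _ → true) α * weight k (λ x → q (bonus k a + x)) β
  weight-glue k q n a α β a≤n α∈ β∈
    rewrite contains132-stacked (map (_+ (n ∸ a)) α) (suc n) β (glue-stacked n a α β a≤n α∈ β∈)
          | mmp-stacked k (map (_+ (n ∸ a)) α) (suc n) β (glue-stacked n a α β a≤n α∈ β∈)
          | length-map (_+ (n ∸ a)) α | length-perms a α∈ | contains132-shift (n ∸ a) α
    with contains132 α
  ... | true  = refl
  ... | false = sym (+-identityʳ _)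

  total-upTo : ∀ n (h : ℕ → ℕ) → total h (upTo (suc n)) ≡ sumℕ n h
  total-upTo n h = trans (cong (total h) (upTo≡interval (suc n))) (by-interval n)
    where
    by-interval : ∀ n → total h (interval 0 (suc n)) ≡ sumℕ n h
    by-interval zero    = +-identityʳ (h 0)
    by-interval (suc n) = trans (cong (total h) (interval-snoc 0 (suc n)))
      (trans (total-++ h (interval 0 (suc n)) (suc n ∷ []))
             (cong₂ _+_ (by-interval n) (+-identityʳ (h (suc n)))))

  avoiders : ℕ → ℕ
  avoiders a = total (weight 0 (λ _ → true)) (perms a)

  weight-recurrence : ∀ k q n → total (weight k q) (perms (suc n)) ≡
    sumℕ n (λ a → avoiders a * total (weight k (λ x → q (bonus k a + x))) (perms (n ∸ a)))
  weight-recurrence k q n = begin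
    total (weight k q) (perms (suc n))
      ≡⟨ total-resp-multiplicity (weight k q) (perms (suc n)) (stackings n) (λ σ w>0 → sym (multiplicity-stackings n σ (avoids σ w>0))) ⟩
    total (weight k q) (stackings n)
      ≡⟨ total-concatMap (weight k q) (stackingsAt n) (upTo (suc n)) ⟩
    total (λ a → total (weight k q) (stackingsAt n a)) (upTo (suc n))
      ≡⟨ total-cong (upTo (suc n)) (λ a a∈ → at-size a (upTo-bound n a∈)) ⟩
    total (λ a → avoiders a * total (weight k (λ x → q (bonus k a + x))) (perms (n ∸ a))) (upTo (suc n))
      ≡⟨ total-upTo n _ ⟩
    sumℕ n (λ a → avoiders a * total (weight k (λ x → q (bonus k a + x))) (perms (n ∸ a)))
      ∎
    where
    open ≡-Reasoning
    -- Only avoiders carry weight; on them the glued permutations enumerate S_{n+1}.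
    avoids : ∀ σ → 0 < weight k q σ → contains132 σ ≡ false
    avoids σ w>0 with contains132 σ
    ... | false = refl
    ... | true  = contradiction w>0 (λ ())
    at-size : ∀ a → a ≤ n → total (weight k q) (stackingsAt n a) ≡
              avoiders a * total (weight k (λ x → q (bonus k a + x))) (perms (n ∸ a))
    at-size a a≤n = begin
      total (weight k q) (stackingsAt n a)
        ≡⟨ total-concatMap (weight k q) (λ α → map (glue n a α) (perms (n ∸ a))) (perms a) ⟩
      total (λ α → total (weight k q) (map (glue n a α) (perms (n ∸ a)))) (perms a)
        ≡⟨ total-cong (perms a) (λ α α∈ → trans (total-map (weight k q) (glue n a α) (perms (n ∸ a)))
             (trans (total-cong (perms (n ∸ a)) (λ β β∈ → weight-glue k q n a α β a≤n α∈ β∈))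
                    (total-*ˡ (weight k (λ _ → true) α) _ (perms (n ∸ a))))) ⟩
      total (λ α → weight k (λ _ → true) α * total (weight k (λ x → q (bonus k a + x))) (perms (n ∸ a))) (perms a)
        ≡⟨ total-*ʳ _ (weight k (λ _ → true)) (perms a) ⟩
      total (weight k (λ _ → true)) (perms a) * total (weight k (λ x → q (bonus k a + x))) (perms (n ∸ a))
        ≡⟨⟩ -- without a condition on mmp, the weight does not depend on k
      avoiders a * total (weight k (λ x → q (bonus k a + x))) (perms (n ∸ a))
        ∎

  -- |S_a(132)| = C_a, by strong induction on a ≤ n via Segner's recurrence.
  avoiders-catalan : ∀ n a → a ≤ n → avoiders a ≡ catalan a
  avoiders-catalan zero    .zero z≤n = refl
  avoiders-catalan (suc n) a a≤1+n with m≤n⇒m<n∨m≡n a≤1+n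
  ... | inj₁ a<1+n = avoiders-catalan n a (≤-pred a<1+n)
  ... | inj₂ refl  = trans (weight-recurrence 0 (λ _ → true) n)
    (trans (sumℕ-cong n (λ a a≤n → cong₂ _*_ (avoiders-catalan n a a≤n)
                                              (avoiders-catalan n (n ∸ a) (m∸n≤m n a))))
           (catalan-convolution n))

  countPerms-total : ∀ k m L → countPerms k m L ≡ total (weight k (_≡ᵇ m)) L
  countPerms-total k m []      = refl
  countPerms-total k m (σ ∷ L) = cong (weight k (_≡ᵇ m) σ +_) (countPerms-total k m L)

  -- Number of σ ∈ S_b(132) with bonus k a + mmp σ = m.
  shiftedCount : ℕ → ℕ → ℕ → ℕ → ℕ
  shiftedCount k zero    a b = if k ≤ᵇ a then 0 else countPerms k 0 (perms b)
  shiftedCount k (suc m) a b = if k ≤ᵇ a then countPerms k m (perms b) else countPerms k (suc m) (perms b)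

  shiftedCount-total : ∀ k m a b → total (weight k (λ x → (bonus k a + x) ≡ᵇ m)) (perms b) ≡ shiftedCount k m a b
  shiftedCount-total k zero a b with k ≤ᵇ a
  ... | true  = total-zero (perms b) (λ σ _ → cong (λ t → if t then 1 else 0) (∧-zeroʳ (not (contains132 σ))))
  ... | false = sym (countPerms-total k 0 (perms b))
  shiftedCount-total k (suc m) a b with k ≤ᵇ a
  ... | true  = sym (countPerms-total k m (perms b))
  ... | false = sym (countPerms-total k (suc m) (perms b))

  countPerms-recurrence : ∀ k m n →
    countPerms k m (perms (suc n)) ≡ sumℕ n (λ a → catalan a * shiftedCount k m a (n ∸ a))
  countPerms-recurrence k m n =
    trans (countPerms-total k m (perms (suc n)))
    (trans (weight-recurrence k (_≡ᵇ m) n)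
           (sumℕ-cong n (λ a a≤n → cong₂ _*_ (avoiders-catalan n a a≤n) (shiftedCount-total k m a (n ∸ a)))))

module PowerSeries where

  open import Data.Nat as ℕ using (ℕ; zero; suc; _∸_; _≤_; _<_; z≤n; s≤s; _<ᵇ_)
  import Data.Nat.Properties as ℕ
  open import Data.Integer using (ℤ; +_; -_; _+_; _*_)
  open import Data.Integer.Properties
  open import Data.Integer.Tactic.RingSolver using (solve-∀)
  open import Data.Bool using (true; false; if_then_else_)
  open import Relation.Binary.PropositionalEquality
  open import Defs
  open CatalanNumbers using (sumℕ)
  open ≡-Reasoning

  sumTo-cong : ∀ n {f g : ℕ → ℤ} → (∀ i → i ≤ n → f i ≡ g i) → sumTo n f ≡ sumTo n g
  sumTo-cong zero    eq = eq 0 z≤n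
  sumTo-cong (suc n) eq = cong₂ _+_ (sumTo-cong n (λ i i≤n → eq i (ℕ.m≤n⇒m≤1+n i≤n))) (eq (suc n) ℕ.≤-refl)

  sumTo-congᶠ : ∀ n {f g : ℕ → ℤ} → (∀ i → f i ≡ g i) → sumTo n f ≡ sumTo n g
  sumTo-congᶠ n eq = sumTo-cong n (λ i _ → eq i)

  sumTo-peel : ∀ n (f : ℕ → ℤ) → sumTo (suc n) f ≡ f 0 + sumTo n (λ i → f (suc i))
  sumTo-peel zero    f = refl
  sumTo-peel (suc n) f rewrite sumTo-peel n f = +-assoc (f 0) _ _

  sumTo-zero : ∀ n {f : ℕ → ℤ} → (∀ i → i ≤ n → f i ≡ + 0) → sumTo n f ≡ + 0
  sumTo-zero zero    eq = eq 0 z≤n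
  sumTo-zero (suc n) eq rewrite sumTo-zero n (λ i i≤n → eq i (ℕ.m≤n⇒m≤1+n i≤n)) | eq (suc n) ℕ.≤-refl = refl

  sumTo-first : ∀ n {f : ℕ → ℤ} → (∀ i → f (suc i) ≡ + 0) → sumTo n f ≡ f 0
  sumTo-first zero    eq = refl
  sumTo-first (suc n) {f} eq =
    trans (sumTo-peel n f) (trans (cong (λ s → f 0 + s) (sumTo-zero n (λ i _ → eq i))) (+-identityʳ (f 0)))

  sumTo-last : ∀ n {f : ℕ → ℤ} → (∀ i → i < n → f i ≡ + 0) → sumTo n f ≡ f n
  sumTo-last zero    eq = refl
  sumTo-last (suc n) {f} eq =
    trans (cong (_+ f (suc n)) (sumTo-zero n (λ i i≤n → eq i (s≤s i≤n)))) (+-identityˡ (f (suc n)))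

  sumTo-+ : ∀ n (f g : ℕ → ℤ) → sumTo n (λ i → f i + g i) ≡ sumTo n f + sumTo n g
  sumTo-+ zero    f g = refl
  sumTo-+ (suc n) f g rewrite sumTo-+ n f g = interchange (sumTo n f) (sumTo n g) (f (suc n)) (g (suc n))
    where interchange : ∀ a b c d → a + b + (c + d) ≡ a + c + (b + d)
          interchange = solve-∀

  sumTo-neg : ∀ n (f : ℕ → ℤ) → sumTo n (λ i → - f i) ≡ - sumTo n f
  sumTo-neg zero    f = refl
  sumTo-neg (suc n) f rewrite sumTo-neg n f = sym (neg-distrib-+ (sumTo n f) (f (suc n)))

  sumTo-cast : ∀ n (f : ℕ → ℕ) → + sumℕ n f ≡ sumTo n (λ i → + f i)
  sumTo-cast zero    f = refl
  sumTo-cast (suc n) f = trans (pos-+ (sumℕ n f) (f (suc n))) (cong (λ s → s + + f (suc n)) (sumTo-cast n f))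

  ≈-trans : ∀ {F G H} → F ≈ₛ G → G ≈ₛ H → F ≈ₛ H
  ≈-trans p q n m = trans (p n m) (q n m)

  ⊕-cong : ∀ {F F′ G G′} → F ≈ₛ F′ → G ≈ₛ G′ → (F ⊕ G) ≈ₛ (F′ ⊕ G′)
  ⊕-cong p q n m = cong₂ _+_ (p n m) (q n m)

  ⊖-cong : ∀ {F F′} → F ≈ₛ F′ → (⊖ F) ≈ₛ (⊖ F′)
  ⊖-cong p n m = cong -_ (p n m)

  ⊗-congˡ : ∀ {F F′} G → F ≈ₛ F′ → (F ⊗ G) ≈ₛ (F′ ⊗ G)
  ⊗-congˡ G p n m = sumTo-congᶠ n (λ a → sumTo-congᶠ m (λ b → cong (_* G (n ∸ a) (m ∸ b)) (p a b)))

  ⊗-congʳ : ∀ F {G G′} → G ≈ₛ G′ → (F ⊗ G) ≈ₛ (F ⊗ G′)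
  ⊗-congʳ F p n m = sumTo-congᶠ n (λ a → sumTo-congᶠ m (λ b → cong (F a b *_) (p (n ∸ a) (m ∸ b))))

  𝟙⊗ : ∀ F → (𝟙 ⊗ F) ≈ₛ F
  𝟙⊗ F n m = trans (sumTo-first n (λ a → sumTo-zero m (λ b _ → refl)))
                   (trans (sumTo-first m (λ b → refl)) (*-identityˡ (F n m)))

  ⊕⊗ : ∀ F G H → ((F ⊕ G) ⊗ H) ≈ₛ ((F ⊗ H) ⊕ (G ⊗ H))
  ⊕⊗ F G H n m = trans (sumTo-congᶠ n (λ a → trans (sumTo-congᶠ m (λ b → *-distribʳ-+ (H (n ∸ a) (m ∸ b)) (F a b) (G a b)))
                                                    (sumTo-+ m _ _)))
                       (sumTo-+ n _ _)

  ⊖⊗ : ∀ F H → ((⊖ F) ⊗ H) ≈ₛ (⊖ (F ⊗ H))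
  ⊖⊗ F H n m = trans (sumTo-congᶠ n (λ a → trans (sumTo-congᶠ m (λ b → sym (neg-distribˡ-* (F a b) (H (n ∸ a) (m ∸ b)))))
                                                  (sumTo-neg m _)))
                     (sumTo-neg n _)

  shiftT : Series → Series
  shiftT F zero    m = + 0
  shiftT F (suc n) m = F n m

  shiftX : Series → Series
  shiftX F n zero    = + 0
  shiftX F n (suc m) = F n m

  shiftT-cong : ∀ {F G} → F ≈ₛ G → shiftT F ≈ₛ shiftT G
  shiftT-cong p zero    m = refl
  shiftT-cong p (suc n) m = p n m

  tS⊗ : ∀ F → (tS ⊗ F) ≈ₛ shiftT F
  tS⊗ F n m = trans (sumTo-congᶠ n (λ a → sumTo-first m (λ b → cong (_* F (n ∸ a) (m ∸ suc b)) (tS-no-x a b))))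
                    (only-t¹ n)
    where
    tS-no-x : ∀ a b → tS a (suc b) ≡ + 0
    tS-no-x zero          b = refl
    tS-no-x (suc zero)    b = refl
    tS-no-x (suc (suc a)) b = refl
    only-t¹ : ∀ n → sumTo n (λ a → tS a 0 * F (n ∸ a) m) ≡ shiftT F n m
    only-t¹ zero    = refl
    only-t¹ (suc n) = trans (sumTo-peel n _) (trans (+-identityˡ _) (trans (sumTo-first n (λ i → refl)) (*-identityˡ (F n m))))

  xS⊗ : ∀ F → (xS ⊗ F) ≈ₛ shiftX F
  xS⊗ F n m = trans (sumTo-first n (λ a → sumTo-zero m (λ b _ → refl))) (only-x¹ m)
    where
    only-x¹ : ∀ m → sumTo m (λ b → xS 0 b * F n (m ∸ b)) ≡ shiftX F n m
    only-x¹ zero    = refl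
    only-x¹ (suc m) = trans (sumTo-peel m _) (trans (+-identityˡ _) (trans (sumTo-first m (λ i → refl)) (*-identityˡ (F n m))))

  shiftT⊗ : ∀ G F → (shiftT G ⊗ F) ≈ₛ shiftT (G ⊗ F)
  shiftT⊗ G F zero    m = sumTo-zero m (λ b _ → refl)
  shiftT⊗ G F (suc n) m = trans (sumTo-peel n _) (trans (cong (_+ (G ⊗ F) n m) (sumTo-zero m (λ b _ → refl))) (+-identityˡ _))

  -- Setting x = 0 is multiplicative, so it preserves inverses.
  atX0-inverse : ∀ F G → (F ⊗ G) ≈ₛ 𝟙 → (atX0 F ⊗ atX0 G) ≈ₛ 𝟙
  atX0-inverse F G FG≈𝟙 n zero    = FG≈𝟙 n zero
  atX0-inverse F G FG≈𝟙 n (suc m) =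
    trans (sumTo-zero n (λ a _ → sumTo-zero (suc m) (λ b _ → no-x a b))) (𝟙-has-no-x n)
    where
    no-x : ∀ a b → atX0 F a b * atX0 G (n ∸ a) (suc m ∸ b) ≡ + 0
    no-x a zero    = *-zeroʳ (F a 0)
    no-x a (suc b) = refl
    𝟙-has-no-x : ∀ n → + 0 ≡ 𝟙 n (suc m)
    𝟙-has-no-x zero    = refl
    𝟙-has-no-x (suc n) = refl

  lowerTerm : (ℕ → ℤ) → (ℕ → ℤ) → ℕ → ℤ
  lowerTerm g h zero    = + 0
  lowerTerm g h (suc m) = g m * h 1

  convolve-linear : ∀ (g h : ℕ → ℤ) m → (∀ j → h (suc (suc j)) ≡ + 0) →
    sumTo m (λ b → g b * h (m ∸ b)) ≡ g m * h 0 + lowerTerm g h m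
  convolve-linear g h zero    h≥2 = sym (+-identityʳ _)
  convolve-linear g h (suc m) h≥2 = begin
    sumTo m (λ b → g b * h (suc m ∸ b)) + g (suc m) * h (m ∸ m)
      ≡⟨ cong₂ _+_ (sumTo-last m (λ b b<m → trans (cong (λ j → g b * h j) (two-apart b b<m))
                                                  (trans (cong (g b *_) (h≥2 _)) (*-zeroʳ (g b)))))
                   (cong (λ j → g (suc m) * h j) (ℕ.n∸n≡0 m)) ⟩
    g m * h (suc m ∸ m) + g (suc m) * h 0
      ≡⟨ cong (λ j → g m * h j + g (suc m) * h 0) (trans (ℕ.+-∸-assoc 1 (ℕ.≤-refl {m})) (cong suc (ℕ.n∸n≡0 m))) ⟩
    g m * h 1 + g (suc m) * h 0
      ≡⟨ +-comm (g m * h 1) (g (suc m) * h 0) ⟩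
    g (suc m) * h 0 + g m * h 1
      ∎
    where
    two-apart : ∀ b → b < m → suc m ∸ b ≡ suc (suc (m ∸ suc b))
    two-apart b b<m = trans (ℕ.+-∸-assoc 1 (ℕ.<⇒≤ b<m)) (cong suc (ℕ.+-∸-assoc 1 b<m))

  -- [p ≥ k] C_p, the part of C_p not in Ctrunc k.
  catalanTail : ℕ → ℕ → ℤ
  catalanTail k p = if p <ᵇ k then + 0 else + catalan p

  -- The coefficients of D_k = 1 - t x C(t) - t (1 - x) Σ_{j<k} C_j t^j.
  denominator : ℕ → Series
  denominator k zero    m             = 𝟙 zero m
  denominator k (suc p) zero          = - Ctrunc k p 0
  denominator k (suc p) (suc zero)    = - catalanTail k p
  denominator k (suc p) (suc (suc m)) = + 0

  txC≈ : (tS ⊗ xS ⊗ Cser) ≈ₛ shiftT (shiftX Cser)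
  txC≈ = ≈-trans (⊗-congˡ Cser (tS⊗ xS)) (≈-trans (shiftT⊗ xS Cser) (shiftT-cong (xS⊗ Cser)))

  t[1-x]T≈ : ∀ k → (tS ⊗ (𝟙 ⊖ xS) ⊗ Ctrunc k) ≈ₛ shiftT (Ctrunc k ⊖ shiftX (Ctrunc k))
  t[1-x]T≈ k = ≈-trans (⊗-congˡ (Ctrunc k) (tS⊗ (𝟙 ⊖ xS))) (≈-trans (shiftT⊗ (𝟙 ⊖ xS) (Ctrunc k)) (shiftT-cong
    (≈-trans (⊕⊗ 𝟙 (⊖ xS) (Ctrunc k)) (⊕-cong (𝟙⊗ (Ctrunc k)) (≈-trans (⊖⊗ xS (Ctrunc k)) (⊖-cong (xS⊗ (Ctrunc k))))))))

  denominator-k : ∀ k → (𝟙 ⊖ tS ⊗ xS ⊗ Cser ⊖ tS ⊗ (𝟙 ⊖ xS) ⊗ Ctrunc k) ≈ₛ denominator k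
  denominator-k k n m = trans (cong₂ (λ u v → 𝟙 n m + - u + - v) (txC≈ n m) (t[1-x]T≈ k n m)) (coefficients n m)
    where
    coefficients : ∀ n m → 𝟙 n m + - shiftT (shiftX Cser) n m + - shiftT (Ctrunc k ⊖ shiftX (Ctrunc k)) n m
                           ≡ denominator k n m
    coefficients zero    zero          = refl
    coefficients zero    (suc m)       = refl
    coefficients (suc p) zero          = trans (cong (λ c → + 0 + + 0 + - c) (+-identityʳ (Ctrunc k p 0)))
                                               (+-identityˡ (- Ctrunc k p 0))
    coefficients (suc p) (suc zero)    = trans (simplify (+ catalan p) (Ctrunc k p 0)) (split (p <ᵇ k))
      where
      simplify : ∀ c y → + 0 + - c + - (+ 0 + - y) ≡ - c + y
      simplify = solve-∀
      split : ∀ b → - (+ catalan p) + (if b then + catalan p else + 0) ≡ - (if b then + 0 else + catalan p)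
      split true  = +-inverseˡ (+ catalan p)
      split false = +-identityʳ _
    coefficients (suc p) (suc (suc m)) = refl

  denominator-0 : (𝟙 ⊖ tS ⊗ xS ⊗ Cser) ≈ₛ denominator 0
  denominator-0 n m = trans (cong (λ u → 𝟙 n m + - u) (txC≈ n m)) (coefficients n m)
    where
    coefficients : ∀ n m → 𝟙 n m + - shiftT (shiftX Cser) n m ≡ denominator 0 n m
    coefficients zero    zero          = refl
    coefficients zero    (suc m)       = refl
    coefficients (suc p) zero          = refl
    coefficients (suc p) (suc zero)    = +-identityˡ (- + catalan p)
    coefficients (suc p) (suc (suc m)) = refl

  denominator-x0 : ∀ k → (𝟙 ⊖ tS ⊗ Ctrunc k) ≈ₛ atX0 (denominator k)
  denominator-x0 k n m = trans (cong (λ u → 𝟙 n m + - u) (tS⊗ (Ctrunc k) n m)) (coefficients n m)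
    where
    coefficients : ∀ n m → 𝟙 n m + - shiftT (Ctrunc k) n m ≡ atX0 (denominator k) n m
    coefficients zero    zero    = refl
    coefficients zero    (suc m) = refl
    coefficients (suc p) zero    = +-identityˡ _
    coefficients (suc p) (suc m) = refl

-- The main identity Q^(∅,0,k,0)_132 · D_k = 1, coefficient by coefficient:
-- the t^{n+1} coefficient of the product is the recurrence for Q_{n+1,m}.
module GeneratingFunction where

  open import Data.Nat as ℕ using (ℕ; zero; suc; _∸_; _≤_; _<ᵇ_; _≤ᵇ_)
  import Data.Nat.Properties as ℕ
  open import Data.Integer using (ℤ; +_; -_; _+_; _*_)
  open import Data.Integer.Properties
  open import Data.Integer.Tactic.RingSolver using (solve-∀)
  open import Data.Bool using (true; false; not)
  open import Relation.Binary.PropositionalEquality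
  open import Defs
  open CatalanNumbers using (sumℕ; sumℕ-cong; sumℕ-reflect)
  open Recurrence using (shiftedCount; countPerms-recurrence)
  open PowerSeries
  open ≡-Reasoning

  -- bonus k p (Recurrence) and the truncations (Defs) use complementary tests.
  ≤ᵇ-as-<ᵇ : ∀ k p → (k ≤ᵇ p) ≡ not (p <ᵇ k)
  ≤ᵇ-as-<ᵇ zero    p       = refl
  ≤ᵇ-as-<ᵇ (suc k) zero    = refl
  ≤ᵇ-as-<ᵇ (suc k) (suc p) = trans (<ᵇ-suc k p) (≤ᵇ-as-<ᵇ k p)
    where <ᵇ-suc : ∀ k p → (k <ᵇ suc p) ≡ (k ≤ᵇ p)
          <ᵇ-suc zero    p = refl
          <ᵇ-suc (suc k) p = refl

  module _ (k : ℕ) where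

    private
      Q : Series
      Q = Q132 k

    Q-recurrence : ∀ n m → Q (suc n) m ≡ sumTo n (λ a → + (catalan (n ∸ a) ℕ.* shiftedCount k m (n ∸ a) a))
    Q-recurrence n m = begin
      + countPerms k m (perms (suc n))
        ≡⟨ cong +_ (countPerms-recurrence k m n) ⟩
      + sumℕ n (λ a → catalan a ℕ.* shiftedCount k m a (n ∸ a))
        ≡⟨ cong +_ (sumℕ-reflect n _) ⟩
      + sumℕ n (λ a → catalan (n ∸ a) ℕ.* shiftedCount k m (n ∸ a) (n ∸ (n ∸ a)))
        ≡⟨ cong +_ (sumℕ-cong n (λ a a≤n → cong (λ j → catalan (n ∸ a) ℕ.* shiftedCount k m (n ∸ a) j)
                                                (ℕ.m∸[m∸n]≡n a≤n))) ⟩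
      + sumℕ n (λ a → catalan (n ∸ a) ℕ.* shiftedCount k m (n ∸ a) a)
        ≡⟨ sumTo-cast n _ ⟩
      sumTo n (λ a → + (catalan (n ∸ a) ℕ.* shiftedCount k m (n ∸ a) a))
        ∎

    -- Column t⁰ of the denominator is 1.
    times-constant : ∀ a m → sumTo m (λ b → Q a b * denominator k 0 (m ∸ b)) ≡ Q a m
    times-constant a m = trans (convolve-linear (Q a) (denominator k 0) m (λ j → refl)) (only-first m)
      where only-first : ∀ m → Q a m * + 1 + lowerTerm (Q a) (denominator k 0) m ≡ Q a m
            only-first zero    = trans (+-identityʳ (Q a 0 * + 1)) (*-identityʳ (Q a 0))
            only-first (suc m) = trans (cong₂ _+_ (*-identityʳ (Q a (suc m))) (*-zeroʳ (Q a m))) (+-identityʳ (Q a (suc m)))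

    -- Row t^{p+1} of the denominator against Q_a cancels the term (p, a) of the recurrence.
    row-cancels : ∀ a p m →
      Q a m * denominator k (suc p) 0 + lowerTerm (Q a) (denominator k (suc p)) m + + (catalan p ℕ.* shiftedCount k m p a) ≡ + 0
    row-cancels a p zero rewrite ≤ᵇ-as-<ᵇ k p with p <ᵇ k
    ... | true  = trans (cong (λ c → Q a 0 * - (+ catalan p) + + 0 + c) (pos-* (catalan p) (countPerms k 0 (perms a))))
                        (cancel (Q a 0) (+ catalan p))
      where cancel : ∀ q c → q * - c + + 0 + c * q ≡ + 0
            cancel = solve-∀
    ... | false = trans (cong (λ c → Q a 0 * - (+ 0) + + 0 + + c) (ℕ.*-zeroʳ (catalan p))) (cancel (Q a 0))
      where cancel : ∀ q → q * - (+ 0) + + 0 + + 0 ≡ + 0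
            cancel = solve-∀
    row-cancels a p (suc m) rewrite ≤ᵇ-as-<ᵇ k p with p <ᵇ k
    ... | true  = trans (cong (λ c → Q a (suc m) * - (+ catalan p) + Q a m * - (+ 0) + c)
                              (pos-* (catalan p) (countPerms k (suc m) (perms a))))
                        (cancel (Q a (suc m)) (+ catalan p) (Q a m))
      where cancel : ∀ q c q′ → q * - c + q′ * - + 0 + c * q ≡ + 0
            cancel = solve-∀
    ... | false = trans (cong (λ c → Q a (suc m) * - (+ 0) + Q a m * - (+ catalan p) + c)
                              (pos-* (catalan p) (countPerms k m (perms a))))
                        (cancel (Q a (suc m)) (+ catalan p) (Q a m))
      where cancel : ∀ q c q′ → q * - + 0 + q′ * - c + c * q′ ≡ + 0
            cancel = solve-∀

    Q⊗denominator : (Q ⊗ denominator k) ≈ₛ 𝟙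
    Q⊗denominator zero    m = trans (times-constant 0 m) (Q₀ m)
      where Q₀ : ∀ m → Q 0 m ≡ 𝟙 0 m
            Q₀ zero    = refl
            Q₀ (suc m) = refl
    Q⊗denominator (suc n) m = begin
      sumTo n column + column (suc n)
        ≡⟨ cong₂ _+_ (sumTo-cong n column≡row) last-column ⟩
      sumTo n (λ a → row a (n ∸ a)) + Q (suc n) m
        ≡⟨ cong (λ s → sumTo n (λ a → row a (n ∸ a)) + s) (Q-recurrence n m) ⟩
      sumTo n (λ a → row a (n ∸ a)) + sumTo n (λ a → + (catalan (n ∸ a) ℕ.* shiftedCount k m (n ∸ a) a))
        ≡⟨ sumTo-+ n _ _ ⟨
      sumTo n (λ a → row a (n ∸ a) + + (catalan (n ∸ a) ℕ.* shiftedCount k m (n ∸ a) a))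
        ≡⟨ sumTo-zero n (λ a _ → row-cancels a (n ∸ a) m) ⟩
      + 0
        ∎
      where
      column : ℕ → ℤ
      column a = sumTo m (λ b → Q a b * denominator k (suc n ∸ a) (m ∸ b))
      row : ℕ → ℕ → ℤ
      row a p = Q a m * denominator k (suc p) 0 + lowerTerm (Q a) (denominator k (suc p)) m
      -- Columns a ≤ n meet the rows t^{p+1} (p = n - a) of the denominator …
      column≡row : ∀ a → a ≤ n → column a ≡ row a (n ∸ a)
      column≡row a a≤n = trans (cong (λ j → sumTo m (λ b → Q a b * denominator k j (m ∸ b))) (ℕ.+-∸-assoc 1 a≤n))
                               (convolve-linear (Q a) (denominator k (suc (n ∸ a))) m (λ j → refl))
      -- … and the last column meets the constant row.
      last-column : column (suc n) ≡ Q (suc n) m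
      last-column = trans (cong (λ j → sumTo m (λ b → Q (suc n) b * denominator k j (m ∸ b))) (ℕ.n∸n≡0 n))
                          (times-constant (suc n) m)

open PowerSeries using (≈-trans; ⊗-congʳ; atX0-inverse; denominator; denominator-0; denominator-k; denominator-x0)
open GeneratingFunction using (Q⊗denominator)

-- The three identities: k = 0 is the case D_0, the second is Q · D_k = 1, and the
-- third is its specialisation at x = 0.
theorem28 :
    (Q132 0 ⊗ (𝟙 ⊖ tS ⊗ xS ⊗ Cser) ≈ₛ 𝟙)
    × (∀ (k : ℕ) → 1 ≤ k →
        (Q132 k ⊗ (𝟙 ⊖ tS ⊗ xS ⊗ Cser ⊖ tS ⊗ (𝟙 ⊖ xS) ⊗ Ctrunc k) ≈ₛ 𝟙)
        × (atX0 (Q132 k) ⊗ (𝟙 ⊖ tS ⊗ Ctrunc k) ≈ₛ 𝟙))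
theorem28 =
    ≈-trans (⊗-congʳ (Q132 0) denominator-0) (Q⊗denominator 0)
  , λ k _ → ≈-trans (⊗-congʳ (Q132 k) (denominator-k k)) (Q⊗denominator k)
          , ≈-trans (⊗-congʳ (atX0 (Q132 k)) (denominator-x0 k))
                    (atX0-inverse (Q132 k) (denominator k) (Q⊗denominator k))
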